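{- Let $\tau=\tau_1\dotsm\tau_l$ be a weak composition with $l\ge 3$ and $\tau_1,\tau_2\ge 1$, and let $(G_1,u_1),\dots,(G_l,u_l)$ be rooted graphs. Let $G=S^\tau(G_1,\dots,G_l)$, and let $H=S^{\tau_3\dotsm\tau_l}(G_3,\dots,G_l)$, regarded as a rooted graph whose root is its center. Then \[ X_G=X_{S^{(\tau_1-1)\tau_2 1}(G_1,\,G_2,\,H)}+X_{G_1^{\tau_1-1}}\,X_{S^{\tau_2\dotsm\tau_l}(G_2,\dots,G_l)}-X_{P^{\tau_1+\tau_2-1}(G_1,G_2)}\,X_H. \]
   Context: All graphs are finite simple graphs; $X_G=\sum_{\kappa}\prod_{v\in V(G)}x_{\kappa(v)}$ over proper colorings $\kappa:V(G)\to\{1,2,\dots\}$ is the chromatic symmetric function. A weak composition is a finite sequence of nonnegative integers. For a weak composition $\tau=\tau_1\dotsm\tau_l$, the spider $S(\tau)$ consists of a center vertex $c$ and $l$ paths (legs) of lengths $\tau_1,\dots,\tau_l$ starting at $c$ and otherwise disjoint; $s_i$ is the far end of the $i$-th leg ($s_i=c$ if $\tau_i=0$). For rooted graphs $(G_i,u_i)$, the spider-conjoined graph $S^\tau(G_1,\dots,G_l)$ is obtained from $S(\tau)$ and disjoint copies of the $G_i$ by identifying $u_i$ with $s_i$ for every $i$; its center is $c$. For rooted graphs $(G,u),(H,v)$ and $k\ge0$, $P^k(G,H)$ is obtained by adding a path of length $k$ linking $u$ and $v$ (identifying them if $k=0$), and the tailed graph is $G^k=P^k(G,K_1)$. -}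

module Defs where

open import Data.Nat using (ℕ; zero; suc; _+_; _∸_)
import Data.Nat as ℕ
open import Data.Fin using (Fin; zero; suc; punchIn; splitAt; _≟_)
open import Data.Bool using (Bool; true; false; not; _∧_; _∨_; if_then_else_)
open import Data.List using (List; []; _∷_; map; concatMap; length; lookup; upTo; allFin; filterᵇ; foldr)
open import Data.Product using (_×_; _,_)
open import Data.Sum using (inj₁; inj₂)
open import Data.Maybe using (Maybe; just; nothing)
open import Data.Integer using (ℤ; +_; _*_; -_)
import Data.Integer as ℤ
open import Relation.Nullary.Decidable using (⌊_⌋)
open import Relation.Binary.PropositionalEquality using (_≡_)

-- A graph on vertex set Fin size is presented by a Bool-valued relation
-- `edge`; vertices i, j are adjacent iff i ≠ j and (edge i j or edge j i).
-- Every finite simple graph (up to relabelling) arises this way.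

record Graph : Set where
  constructor graph
  field
    size : ℕ
    edge : Fin size → Fin size → Bool

adjacent : (G : Graph) → Fin (Graph.size G) → Fin (Graph.size G) → Bool
adjacent (graph n e) i j = not ⌊ i ≟ j ⌋ ∧ (e i j ∨ e j i)

record Rooted : Set where
  constructor rooted
  field
    n    : ℕ
    edge : Fin (suc n) → Fin (suc n) → Bool
    root : Fin (suc n)

underlying : Rooted → Graph
underlying (rooted n e r) = graph (suc n) e

K1 : Rooted
K1 = rooted 0 (λ _ _ → false) zero

extend : Rooted → Rooted
extend (rooted n e r) = rooted (suc n) e' zero
  where
  e' : Fin (suc (suc n)) → Fin (suc (suc n)) → Bool
  e' zero    zero    = false
  e' zero    (suc j) = ⌊ j ≟ r ⌋
  e' (suc i) zero    = ⌊ i ≟ r ⌋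
  e' (suc i) (suc j) = e i j

-- extendN k (G , u): attach a path of length k at u; the new root is the
-- far end of that path (for k = 0 this is (G , u) itself).
extendN : ℕ → Rooted → Rooted
extendN zero    G = G
extendN (suc k) G = extend (extendN k G)

-- wedge (G , u) (H , v): disjoint union with u and v identified;
-- the identified vertex (vertex 0) is the root.
wedge : Rooted → Rooted → Rooted
wedge (rooted a e r) (rooted b f s) = rooted (a + b) w zero
  where
  toG : Fin (suc (a + b)) → Maybe (Fin (suc a))
  toG zero = just r
  toG (suc y) with splitAt a y
  ... | inj₁ p = just (punchIn r p)
  ... | inj₂ _ = nothing
  toH : Fin (suc (a + b)) → Maybe (Fin (suc b))
  toH zero = just s
  toH (suc y) with splitAt a y
  ... | inj₁ _ = nothing
  ... | inj₂ q = just (punchIn s q)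
  both : ∀ {m} → (Fin m → Fin m → Bool) → Maybe (Fin m) → Maybe (Fin m) → Bool
  both g (just i) (just j) = g i j
  both g _ _ = false
  w : Fin (suc (a + b)) → Fin (suc (a + b)) → Bool
  w x y = both e (toG x) (toG y) ∨ both f (toH x) (toH y)

-- Spider-conjoined graph S^τ(G₁,…,G_l), given as the list of legs
-- (τ₁ , G₁) ∷ … ∷ (τ_l , G_l); rooted at its center c.
-- Leg i is (G_i , u_i) with a path of length τ_i attached at u_i, whose far
-- end is c; all legs are glued at c.
spider : List (ℕ × Rooted) → Rooted
spider []             = K1
spider ((t , G) ∷ ls) = wedge (extendN t G) (spider ls)

-- P^k(G , H): a path of length k linking the roots (identified if k = 0).
P : ℕ → Rooted → Rooted → Graph
P k G H = underlying (wedge (extendN k G) H)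

tailed : ℕ → Rooted → Graph
tailed k G = P k G K1

-- Formal power series in x₁, x₂, … with integer coefficients.
-- A monomial x₁^{α₁} ⋯ x_k^{α_k} is given by the list α = α₁ ∷ … ∷ α_k
-- (trailing zeros denote the same monomial); a series is its coefficient map.

Series : Set
Series = List ℕ → ℤ

_≈_ : Series → Series → Set
f ≈ g = ∀ α → f α ≡ g α

infix  4 _≈_
infixl 6 _⊕_ _⊖_
infixl 7 _⊗_

_⊕_ : Series → Series → Series
(f ⊕ g) α = f α ℤ.+ g α

_⊖_ : Series → Series → Series
(f ⊖ g) α = f α ℤ.- g α

splits : List ℕ → List (List ℕ × List ℕ)
splits []      = ([] , []) ∷ []
splits (a ∷ α) =
  concatMap (λ i → map (λ { (β , γ) → (i ∷ β , (a ∸ i) ∷ γ) }) (splits α))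
            (upTo (suc a))

sumℤ : List ℤ → ℤ
sumℤ = foldr ℤ._+_ (+ 0)

_⊗_ : Series → Series → Series
(f ⊗ g) α = sumℤ (map (λ { (β , γ) → f β * g γ }) (splits α))

allᵇ : {A : Set} → (A → Bool) → List A → Bool
allᵇ p []       = true
allᵇ p (x ∷ xs) = p x ∧ allᵇ p xs

allMaps : (m k : ℕ) → List (Fin m → Fin k)
allMaps zero    k = (λ ()) ∷ []
allMaps (suc m) k =
  concatMap (λ c → map (λ f → λ { zero → c ; (suc i) → f i }) (allMaps m k))
            (allFin k)

proper : (G : Graph) {k : ℕ} → (Fin (Graph.size G) → Fin k) → Bool
proper G κ =
  allᵇ (λ i → allᵇ (λ j → not (adjacent G i j ∧ ⌊ κ i ≟ κ j ⌋))
                 (allFin (Graph.size G)))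
      (allFin (Graph.size G))

fiberSize : {m k : ℕ} → (Fin m → Fin k) → Fin k → ℕ
fiberSize {m} κ c = length (filterᵇ (λ v → ⌊ κ v ≟ c ⌋) (allFin m))

hasType : {m : ℕ} (α : List ℕ) → (Fin m → Fin (length α)) → Bool
hasType α κ = allᵇ (λ c → ⌊ fiberSize κ c ℕ.≟ lookup α c ⌋) (allFin (length α))

X : Graph → Series
X G α = + length (filterᵇ (λ κ → proper G κ ∧ hasType α κ)
                          (allMaps (Graph.size G) (length α)))

module Submission where

-- Fix k colours. The coefficient of x^α in X_G counts the proper colourings whose vector of colour
-- counts is α, and the product of two such series adds these vectors. For a rooted graph R and a
-- colour c, weigh the proper colourings of R with root colour c by the colour counts of the other
-- vertices: gluing rooted graphs at their roots multiplies these weighted counts, and attaching a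
-- new root to the old one by an edge sums them over the colours d ≠ c of the old root.
-- Let E be G₁ with a tail of length τ₁ − 1, A be G₂ with a tail of length τ₂ − 1 and H the spider on
-- the remaining legs. Then each of the four series in the identity is a sum, over the root colours
-- a, d, b of E, A, H, of one common term weighted by [b≠a][b≠d], [a≠d][a≠b], [b≠d] and [a≠d]
-- respectively, and [b≠a][b≠d] + [a≠d] = [a≠d][a≠b] + [b≠d] for any three colours. For the last
-- term, P^{τ₁+τ₂−1}(G₁,G₂) becomes E joined to A by an edge after sliding the edges of the path
-- across the gluing point one at a time, which leaves X unchanged.

module Sums where

  open import Data.Nat as ℕ using (ℕ; zero; suc)
  open import Data.Fin using (Fin; zero; suc)
  open import Data.Vec using (Vec; []; _∷_; _++_; insertAt)
  open import Data.Integer using (ℤ; _+_; _*_)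
  open import Data.Integer.Properties using (+-*-semiring; +-commutativeSemigroup)
  open import Algebra.Properties.Semiring.Sum +-*-semiring public
    using (sum; sum-syntax; sum-cong-≗; *-distribˡ-sum; sum-replicate-zero)
  open import Algebra.Properties.CommutativeSemigroup +-commutativeSemigroup
    using () renaming (interchange to +-interchange)
  open import Relation.Binary.PropositionalEquality

  sum-+ : ∀ {k} (f g : Fin k → ℤ) → ∑[ c < k ] (f c + g c) ≡ sum f + sum g
  sum-+ {zero}  f g = refl
  sum-+ {suc k} f g = trans (cong (f zero + g zero +_) (sum-+ (λ c → f (suc c)) (λ c → g (suc c))))
    (+-interchange (f zero) (g zero) (sum (λ c → f (suc c))) (sum (λ c → g (suc c))))

  sum-comm : ∀ {k l} (F : Fin k → Fin l → ℤ) →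
    ∑[ c < k ] ∑[ d < l ] F c d ≡ ∑[ d < l ] ∑[ c < k ] F c d
  sum-comm {zero}  {l} F = sym (sum-replicate-zero l)
  sum-comm {suc k} F = trans (cong (sum (F zero) +_) (sum-comm (λ c → F (suc c))))
    (sym (sum-+ (F zero) (λ d → ∑[ c < k ] F (suc c) d)))

  sumVec : (m k : ℕ) → (Vec (Fin k) m → ℤ) → ℤ
  sumVec zero    k F = F []
  sumVec (suc m) k F = ∑[ c < k ] sumVec m k (λ v → F (c ∷ v))

  infixl 10 sumVec
  syntax sumVec m k (λ v → x) = ∑[ v ∈ k ^ m ] x

  module _ {k : ℕ} where

    sumVec-cong : ∀ m {F G : Vec (Fin k) m → ℤ} → (∀ v → F v ≡ G v) → sumVec m k F ≡ sumVec m k G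
    sumVec-cong zero    F≗G = F≗G []
    sumVec-cong (suc m) F≗G = sum-cong-≗ (λ c → sumVec-cong m (λ v → F≗G (c ∷ v)))

    sumVec-+ : ∀ m (F G : Vec (Fin k) m → ℤ) → ∑[ v ∈ k ^ m ] (F v + G v) ≡ sumVec m k F + sumVec m k G
    sumVec-+ zero    F G = refl
    sumVec-+ (suc m) F G = trans (sum-cong-≗ (λ c → sumVec-+ m (λ v → F (c ∷ v)) (λ v → G (c ∷ v))))
      (sum-+ (λ c → sumVec m k (λ v → F (c ∷ v))) (λ c → sumVec m k (λ v → G (c ∷ v))))

    *-distribˡ-sumVec : ∀ m s (F : Vec (Fin k) m → ℤ) → s * sumVec m k F ≡ ∑[ v ∈ k ^ m ] (s * F v)
    *-distribˡ-sumVec zero    s F = refl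
    *-distribˡ-sumVec (suc m) s F =
      trans (*-distribˡ-sum s (λ c → sumVec m k (λ v → F (c ∷ v))))
        (sum-cong-≗ (λ c → *-distribˡ-sumVec m s (λ v → F (c ∷ v))))

    sumVec-comm-sum : ∀ m {l} (F : Vec (Fin k) m → Fin l → ℤ) →
      ∑[ v ∈ k ^ m ] ∑[ d < l ] F v d ≡ ∑[ d < l ] ∑[ v ∈ k ^ m ] F v d
    sumVec-comm-sum zero    F = refl
    sumVec-comm-sum (suc m) F = trans (sum-cong-≗ (λ c → sumVec-comm-sum m (λ v → F (c ∷ v))))
      (sum-comm (λ c d → sumVec m k (λ v → F (c ∷ v) d)))

    sumVec-++ : ∀ a b (F : Vec (Fin k) (a ℕ.+ b) → ℤ) →
      sumVec (a ℕ.+ b) k F ≡ ∑[ v ∈ k ^ a ] ∑[ w ∈ k ^ b ] F (v ++ w)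
    sumVec-++ zero    b F = refl
    sumVec-++ (suc a) b F = sum-cong-≗ (λ c → sumVec-++ a b (λ v → F (c ∷ v)))

    sumVec-insertAt : ∀ n (r : Fin (suc n)) (F : Vec (Fin k) (suc n) → ℤ) →
      sumVec (suc n) k F ≡ ∑[ c < k ] ∑[ v ∈ k ^ n ] F (insertAt v r c)
    sumVec-insertAt n       zero    F = refl
    sumVec-insertAt (suc n) (suc r) F =
      trans (sum-cong-≗ (λ x → sumVec-insertAt n r (λ u → F (x ∷ u))))
        (sum-comm (λ x c → sumVec n k (λ v → F (x ∷ insertAt v r c))))

module ColourCounts where

  open import Data.Nat as ℕ using (ℕ; zero; suc)
  import Data.Nat.Properties as ℕ
  open import Data.Fin using (Fin; zero; suc; _≟_)
  open import Data.Vec using (Vec; []; _∷_; lookup; zipWith; replicate; tabulate; _++_; insertAt)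
  open import Data.Vec.Properties
    using (lookup-zipWith; lookup∘tabulate; tabulate∘lookup; lookup-replicate;
           zipWith-assoc; zipWith-identityˡ; zipWith-identityʳ; zipWith-comm)
  import Data.List as List
  open import Data.List using (List; length; filterᵇ)
  open import Data.Bool using (if_then_else_)
  open import Data.Product using (_,_)
  open import Algebra.Bundles using (CommutativeMonoid)
  open import Relation.Nullary using (yes; no)
  open import Relation.Nullary.Decidable using (⌊_⌋)
  open import Relation.Binary.PropositionalEquality
  open import Defs using (fiberSize)

  module _ {k : ℕ} where

    infixr 6 _⊞_

    _⊞_ : Vec ℕ k → Vec ℕ k → Vec ℕ k
    _⊞_ = zipWith ℕ._+_

    0̄ : Vec ℕ k
    0̄ = replicate k 0

    δ : Fin k → Vec ℕ k
    δ x = tabulate (λ c → if ⌊ x ≟ c ⌋ then 1 else 0)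

    colourCount : ∀ {m} → Vec (Fin k) m → Vec ℕ k
    colourCount []      = 0̄
    colourCount (x ∷ v) = δ x ⊞ colourCount v

  ⊞-0̄-commutativeMonoid : ℕ → CommutativeMonoid _ _
  ⊞-0̄-commutativeMonoid k = record
    { Carrier = Vec ℕ k ; _≈_ = _≡_ ; _∙_ = _⊞_ ; ε = 0̄
    ; isCommutativeMonoid = record
      { isMonoid = record
        { isSemigroup = record
          { isMagma = record { isEquivalence = isEquivalence ; ∙-cong = cong₂ _⊞_ }
          ; assoc = zipWith-assoc ℕ.+-assoc }
        ; identity = zipWith-identityˡ ℕ.+-identityˡ , zipWith-identityʳ ℕ.+-identityʳ }
      ; comm = zipWith-comm ℕ.+-comm } }

  module _ {k : ℕ} where
    open CommutativeMonoid (⊞-0̄-commutativeMonoid k) using (identityˡ; assoc; commutativeSemigroup)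
    open import Algebra.Properties.CommutativeSemigroup commutativeSemigroup using (x∙yz≈y∙xz)

    colourCount-++ : ∀ {a b} (v : Vec (Fin k) a) (w : Vec (Fin k) b) →
      colourCount (v ++ w) ≡ colourCount v ⊞ colourCount w
    colourCount-++ []      w = sym (identityˡ (colourCount w))
    colourCount-++ (x ∷ v) w =
      trans (cong (δ x ⊞_) (colourCount-++ v w)) (sym (assoc (δ x) (colourCount v) (colourCount w)))

    colourCount-insertAt : ∀ {n} (v : Vec (Fin k) n) r x →
      colourCount (insertAt v r x) ≡ δ x ⊞ colourCount v
    colourCount-insertAt v       zero    x = refl
    colourCount-insertAt (y ∷ v) (suc r) x =
      trans (cong (δ y ⊞_) (colourCount-insertAt v r x)) (x∙yz≈y∙xz (δ y) (δ x) (colourCount v))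

    lookup-colourCount-tabulate : ∀ {n} {A : Set} (f : Fin n → A) (h : A → Fin k) c →
      length (filterᵇ (λ i → ⌊ h i ≟ c ⌋) (List.tabulate f)) ≡ lookup (colourCount (tabulate (λ i → h (f i)))) c
    lookup-colourCount-tabulate {zero}  f h c = sym (lookup-replicate c 0)
    lookup-colourCount-tabulate {suc n} f h c
      rewrite lookup-zipWith ℕ._+_ c (δ (h (f zero))) (colourCount (tabulate (λ i → h (f (suc i)))))
            | lookup∘tabulate (λ d → if ⌊ h (f zero) ≟ d ⌋ then 1 else 0) c
      with h (f zero) ≟ c
    ... | yes _ = cong suc (lookup-colourCount-tabulate (λ i → f (suc i)) h c)
    ... | no  _ = lookup-colourCount-tabulate (λ i → f (suc i)) h c

    fiberSize-colourCount : ∀ {m} (v : Vec (Fin k) m) c → fiberSize (lookup v) c ≡ lookup (colourCount v) c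
    fiberSize-colourCount v c =
      trans (lookup-colourCount-tabulate (λ i → i) (lookup v) c) (cong (λ w → lookup (colourCount w) c) (tabulate∘lookup v))

module Colourings where

  open import Data.Nat as ℕ using (ℕ; zero; suc)
  open import Data.Fin using (Fin; zero; suc; _≟_)
  open import Data.Vec using (Vec; []; _∷_; lookup; toList)
  import Data.List as List
  open import Data.List using (List; length; filterᵇ; concat; concatMap; tabulate; allFin)
  open import Data.List.Properties using (≡-dec; filter-++; length-++; map-tabulate)
  open import Data.Bool using (Bool; true; false; T?; _∧_; not)
  open import Data.Integer using (ℤ; +_; _+_; _*_; 0ℤ; 1ℤ)
  open import Data.Integer.Properties using (pos-+; *-identityˡ; *-distribˡ-+; *-commutativeSemigroup)
  open import Algebra.Properties.CommutativeSemigroup *-commutativeSemigroup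
    using () renaming (x∙yz≈y∙xz to *-x∙yz≈y∙xz)
  open import Relation.Nullary using (yes; no)
  open import Relation.Nullary.Decidable using (⌊_⌋)
  open import Relation.Binary using (DecidableEquality)
  open import Relation.Binary.PropositionalEquality
  open import Defs using (Graph; adjacent; proper; hasType; allᵇ; allMaps; X)
  open Sums
  open ColourCounts

  iverson : Bool → ℤ
  iverson true  = 1ℤ
  iverson false = 0ℤ

  iverson-∧ : ∀ a b → iverson (a ∧ b) ≡ iverson a * iverson b
  iverson-∧ true  b = sym (*-identityˡ (iverson b))
  iverson-∧ false b = refl

  _≟ᴸ_ : DecidableEquality (List ℕ)
  _≟ᴸ_ = ≡-dec ℕ._≟_

  ≟ᴸ-∷ : ∀ x y xs ys → ⌊ (x List.∷ xs) ≟ᴸ (y List.∷ ys) ⌋ ≡ ⌊ x ℕ.≟ y ⌋ ∧ ⌊ xs ≟ᴸ ys ⌋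
  ≟ᴸ-∷ x y xs ys with x ℕ.≟ y | xs ≟ᴸ ys
  ... | yes _ | yes _ = refl
  ... | yes _ | no  _ = refl
  ... | no  _ | _     = refl

  𝟙[_] : ∀ {k} → List ℕ → Vec ℕ k → ℤ
  𝟙[ α ] t = iverson ⌊ toList t ≟ᴸ α ⌋

  allᵇ-cong : ∀ {A : Set} {p q : A → Bool} → (∀ x → p x ≡ q x) → ∀ xs → allᵇ p xs ≡ allᵇ q xs
  allᵇ-cong p≗q List.[]       = refl
  allᵇ-cong p≗q (x List.∷ xs) = cong₂ _∧_ (p≗q x) (allᵇ-cong p≗q xs)

  allᵇ-tabulate : ∀ {n} {A : Set} (p : A → Bool) (f : Fin n → A) →
    allᵇ p (tabulate f) ≡ allᵇ (λ i → p (f i)) (allFin n)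
  allᵇ-tabulate {zero}  p f = refl
  allᵇ-tabulate {suc n} p f = cong (p (f zero) ∧_)
    (trans (allᵇ-tabulate p (λ i → f (suc i))) (sym (allᵇ-tabulate (λ i → p (f i)) suc)))

  allᵇ-lookup-≟ᴸ : ∀ α (t : Vec ℕ (length α)) →
    allᵇ (λ c → ⌊ lookup t c ℕ.≟ List.lookup α c ⌋) (allFin (length α)) ≡ ⌊ toList t ≟ᴸ α ⌋
  allᵇ-lookup-≟ᴸ List.[]       []      = refl
  allᵇ-lookup-≟ᴸ (a List.∷ α) (x ∷ t) = trans
    (cong (⌊ x ℕ.≟ a ⌋ ∧_)
      (trans (allᵇ-tabulate (λ c → ⌊ lookup (x ∷ t) c ℕ.≟ List.lookup (a List.∷ α) c ⌋) suc)
        (allᵇ-lookup-≟ᴸ α t)))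
    (sym (≟ᴸ-∷ x a (toList t) α))

  hasType-colourCount : ∀ {m} α (v : Vec (Fin (length α)) m) →
    hasType α (lookup v) ≡ ⌊ toList (colourCount v) ≟ᴸ α ⌋
  hasType-colourCount α v = trans
    (allᵇ-cong (λ c → cong (λ n → ⌊ n ℕ.≟ List.lookup α c ⌋) (fiberSize-colourCount v c)) (allFin (length α)))
    (allᵇ-lookup-≟ᴸ α (colourCount v))

  filterᵇ-cong : ∀ {A : Set} {p q : A → Bool} → (∀ x → p x ≡ q x) → ∀ xs → filterᵇ p xs ≡ filterᵇ q xs
  filterᵇ-cong             p≗q List.[]       = refl
  filterᵇ-cong {p = p} {q} p≗q (x List.∷ xs) with p x | q x | p≗q x
  ... | true  | true  | refl = cong (x List.∷_) (filterᵇ-cong p≗q xs)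
  ... | false | false | refl = filterᵇ-cong p≗q xs

  RespectsPointwise : ∀ {m k} → ((Fin m → Fin k) → Bool) → Set
  RespectsPointwise p = ∀ {κ κ'} → (∀ i → κ i ≡ κ' i) → p κ ≡ p κ'

  module _ {A : Set} (p : A → Bool) where

    length-filterᵇ-++ : ∀ xs ys →
      + length (filterᵇ p (xs List.++ ys)) ≡ + length (filterᵇ p xs) + + length (filterᵇ p ys)
    length-filterᵇ-++ xs ys = trans
      (cong +_ (trans (cong length (filter-++ (λ x → T? (p x)) xs ys)) (length-++ (filterᵇ p xs))))
      (pos-+ (length (filterᵇ p xs)) (length (filterᵇ p ys)))

    length-filterᵇ-concat : ∀ {k} (h : Fin k → List A) →
      + length (filterᵇ p (concat (tabulate h))) ≡ ∑[ c < k ] (+ length (filterᵇ p (h c)))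
    length-filterᵇ-concat {zero}  h = refl
    length-filterᵇ-concat {suc k} h = trans (length-filterᵇ-++ (h zero) (concat (tabulate (λ c → h (suc c)))))
      (cong (λ s → + length (filterᵇ p (h zero)) + s) (length-filterᵇ-concat (λ c → h (suc c))))

    length-filterᵇ-map : ∀ {B : Set} (g : B → A) xs →
      length (filterᵇ p (List.map g xs)) ≡ length (filterᵇ (λ x → p (g x)) xs)
    length-filterᵇ-map g List.[]       = refl
    length-filterᵇ-map g (x List.∷ xs) with p (g x)
    ... | true  = cong suc (length-filterᵇ-map g xs)
    ... | false = length-filterᵇ-map g xs

  count-allMaps : ∀ m k (p : (Fin m → Fin k) → Bool) → RespectsPointwise p →
    + length (filterᵇ p (allMaps m k)) ≡ ∑[ v ∈ k ^ m ] iverson (p (lookup v))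
  count-allMaps zero k p resp = single _
    where
    single : (f₀ : Fin 0 → Fin k) → + length (filterᵇ p (f₀ List.∷ List.[])) ≡ iverson (p (lookup []))
    single f₀ with p f₀ | resp {f₀} {lookup []} (λ ())
    ... | true  | eq = cong iverson eq
    ... | false | eq = cong iverson eq
  count-allMaps (suc m) k p resp = consCase _ (λ c f → refl) (λ c f i → refl)
    where
    -- allMaps extends maps by an anonymous pattern-matching lambda; abstracting over it leaves
    -- only its two defining equations to work with.
    consCase : (cons : Fin k → (Fin m → Fin k) → Fin (suc m) → Fin k) →
      (∀ c f → cons c f zero ≡ c) → (∀ c f i → cons c f (suc i) ≡ f i) →
      + length (filterᵇ p (concatMap (λ c → List.map (cons c) (allMaps m k)) (allFin k)))
        ≡ ∑[ v ∈ k ^ suc m ] iverson (p (lookup v))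
    consCase cons cons-zero cons-suc = begin
      + length (filterᵇ p (concat (List.map (λ c → List.map (cons c) (allMaps m k)) (allFin k))))
        ≡⟨ cong (λ xs → + length (filterᵇ p (concat xs)))
             (map-tabulate {n = k} (λ c → c) (λ c → List.map (cons c) (allMaps m k))) ⟩
      + length (filterᵇ p (concat (tabulate (λ c → List.map (cons c) (allMaps m k)))))
        ≡⟨ length-filterᵇ-concat p (λ c → List.map (cons c) (allMaps m k)) ⟩
      ∑[ c < k ] (+ length (filterᵇ p (List.map (cons c) (allMaps m k))))
        ≡⟨ sum-cong-≗ (λ c → cong +_ (length-filterᵇ-map p (cons c) (allMaps m k))) ⟩
      ∑[ c < k ] (+ length (filterᵇ (λ f → p (cons c f)) (allMaps m k)))
        ≡⟨ sum-cong-≗ (λ c → count-allMaps m k (λ f → p (cons c f)) (λ κ≗κ' → resp (consCong c κ≗κ'))) ⟩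
      ∑[ c < k ] ∑[ v ∈ k ^ m ] iverson (p (cons c (lookup v)))
        ≡⟨ sum-cong-≗ (λ c → sumVec-cong m (λ v → cong iverson (resp λ where
             zero    → cons-zero c (lookup v)
             (suc i) → cons-suc c (lookup v) i))) ⟩
      ∑[ v ∈ k ^ suc m ] iverson (p (lookup v)) ∎
      where
      open ≡-Reasoning
      consCong : ∀ c {κ κ'} → (∀ i → κ i ≡ κ' i) → ∀ i → cons c κ i ≡ cons c κ' i
      consCong c {κ} {κ'} κ≗κ' zero    = trans (cons-zero c κ) (sym (cons-zero c κ'))
      consCong c {κ} {κ'} κ≗κ' (suc i) = trans (cons-suc c κ i) (trans (κ≗κ' i) (sym (cons-suc c κ' i)))

  module _ {m k : ℕ} (w : Vec (Fin k) m → ℤ) where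

    integrate : (Vec ℕ k → ℤ) → ℤ
    integrate F = ∑[ v ∈ k ^ m ] (w v * F (colourCount v))

    integrate-cong : ∀ {F G : Vec ℕ k → ℤ} → (∀ t → F t ≡ G t) → integrate F ≡ integrate G
    integrate-cong F≗G = sumVec-cong m (λ v → cong (w v *_) (F≗G (colourCount v)))

    *-integrate : ∀ s (F : Vec ℕ k → ℤ) → s * integrate F ≡ integrate (λ t → s * F t)
    *-integrate s F = trans (*-distribˡ-sumVec m s (λ v → w v * F (colourCount v)))
      (sumVec-cong m (λ v → *-x∙yz≈y∙xz s (w v) (F (colourCount v))))

    integrate-+ : ∀ (F G : Vec ℕ k → ℤ) → integrate (λ t → F t + G t) ≡ integrate F + integrate G
    integrate-+ F G = trans (sumVec-cong m (λ v → *-distribˡ-+ (w v) (F (colourCount v)) (G (colourCount v))))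
      (sumVec-+ m (λ v → w v * F (colourCount v)) (λ v → w v * G (colourCount v)))

    integrate-sum : ∀ {l} (F : Fin l → Vec ℕ k → ℤ) →
      integrate (λ t → ∑[ d < l ] F d t) ≡ ∑[ d < l ] integrate (F d)
    integrate-sum F = trans
      (sumVec-cong m (λ v → *-distribˡ-sum (w v) (λ d → F d (colourCount v))))
      (sumVec-comm-sum m (λ v d → w v * F d (colourCount v)))

  properWeight : (G : Graph) {k : ℕ} → Vec (Fin k) (Graph.size G) → ℤ
  properWeight G v = iverson (proper G (lookup v))

  colourings : (G : Graph) {k : ℕ} → (Vec ℕ k → ℤ) → ℤ
  colourings G = integrate (properWeight G)

  proper∧hasType-respects : ∀ G α → RespectsPointwise {Graph.size G} {length α} (λ κ → proper G κ ∧ hasType α κ)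
  proper∧hasType-respects G α κ≗κ' = cong₂ _∧_
    (allᵇ-cong (λ i → allᵇ-cong (λ j → cong₂ (λ a b → not (adjacent G i j ∧ ⌊ a ≟ b ⌋)) (κ≗κ' i) (κ≗κ' j))
      (allFin (Graph.size G))) (allFin (Graph.size G)))
    (allᵇ-cong (λ c → cong (λ xs → ⌊ length xs ℕ.≟ List.lookup α c ⌋)
      (filterᵇ-cong (λ i → cong (λ a → ⌊ a ≟ c ⌋) (κ≗κ' i)) (allFin (Graph.size G)))) (allFin (length α)))

  X-colourings : ∀ G α → X G α ≡ colourings G 𝟙[ α ]
  X-colourings G α = trans (count-allMaps _ _ _ (proper∧hasType-respects G α))
    (sumVec-cong (Graph.size G) λ v → trans (iverson-∧ (proper G (lookup v)) (hasType α (lookup v)))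
      (cong (λ b → iverson (proper G (lookup v)) * iverson b) (hasType-colourCount α v)))

module SeriesProduct where

  open import Data.Nat as ℕ using (ℕ; zero; suc; _∸_)
  import Data.Nat.Properties as ℕ
  open import Data.Fin using (Fin)
  open import Data.Vec using (Vec; []; _∷_; toList; lookup)
  open import Data.Vec.Properties using (length-toList)
  open import Data.List using (List; []; _∷_; length; map; concatMap; zipWith; applyUpTo; upTo)
  open import Data.List.Properties using (map-cong; map-∘; map-upTo)
  open import Data.Product using (_×_; _,_; proj₁; proj₂)
  open import Data.Bool using (_∧_)
  open import Data.Integer using (ℤ; _+_; _*_; 0ℤ)
  open import Data.Integer.Properties
    using (+-identityˡ; +-identityʳ; +-assoc; *-identityˡ; *-zeroˡ; *-zeroʳ; *-comm;
           *-distribˡ-+; *-distribʳ-+; *-commutativeSemigroup)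
  open import Relation.Nullary using (yes; no; contradiction)
  open import Relation.Nullary.Decidable using (⌊_⌋)
  open import Relation.Binary.PropositionalEquality
  open import Defs using (Graph; proper; Series; _≈_; X; _⊗_; splits; sumℤ)
  open import Algebra.Properties.CommutativeSemigroup *-commutativeSemigroup using () renaming (interchange to *-interchange)
  open Sums
  open ColourCounts
  open Colourings

  sumℤ-++ : ∀ xs ys → sumℤ (xs Data.List.++ ys) ≡ sumℤ xs + sumℤ ys
  sumℤ-++ []       ys = sym (+-identityˡ (sumℤ ys))
  sumℤ-++ (x ∷ xs) ys = trans (cong (x +_) (sumℤ-++ xs ys)) (sym (+-assoc x (sumℤ xs) (sumℤ ys)))

  sumℤ-map-cong : ∀ {A : Set} {f g : A → ℤ} → (∀ x → f x ≡ g x) → ∀ xs → sumℤ (map f xs) ≡ sumℤ (map g xs)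
  sumℤ-map-cong f≗g xs = cong sumℤ (map-cong f≗g xs)

  sumℤ-map-concatMap-map : ∀ {A B C : Set} (h : C → ℤ) (g : A → B → C) (ys : List B) (xs : List A) →
    sumℤ (map h (concatMap (λ x → map (g x) ys) xs)) ≡ sumℤ (map (λ x → sumℤ (map (λ y → h (g x y)) ys)) xs)
  sumℤ-map-concatMap-map h g ys []       = refl
  sumℤ-map-concatMap-map h g ys (x ∷ xs) = begin
    sumℤ (map h (map (g x) ys Data.List.++ concatMap (λ x → map (g x) ys) xs))
      ≡⟨ cong sumℤ (Data.List.Properties.map-++ h (map (g x) ys) _) ⟩
    sumℤ (map h (map (g x) ys) Data.List.++ map h (concatMap (λ x → map (g x) ys) xs))
      ≡⟨ sumℤ-++ (map h (map (g x) ys)) _ ⟩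
    sumℤ (map h (map (g x) ys)) + sumℤ (map h (concatMap (λ x → map (g x) ys) xs))
      ≡⟨ cong₂ _+_ (cong sumℤ (sym (map-∘ ys))) (sumℤ-map-concatMap-map h g ys xs) ⟩
    sumℤ (map (λ y → h (g x y)) ys) + sumℤ (map (λ x → sumℤ (map (λ y → h (g x y)) ys)) xs) ∎
    where open ≡-Reasoning

  *-sumℤ-map : ∀ {A : Set} s (h : A → ℤ) xs → s * sumℤ (map h xs) ≡ sumℤ (map (λ x → s * h x) xs)
  *-sumℤ-map s h []       = *-zeroʳ s
  *-sumℤ-map s h (x ∷ xs) = trans (*-distribˡ-+ s (h x) _) (cong (s * h x +_) (*-sumℤ-map s h xs))

  sumℤ-map-*ʳ : ∀ {A : Set} (h : A → ℤ) s xs → sumℤ (map (λ x → h x * s) xs) ≡ sumℤ (map h xs) * s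
  sumℤ-map-*ʳ h s []       = sym (*-zeroˡ s)
  sumℤ-map-*ʳ h s (x ∷ xs) = trans (cong (h x * s +_) (sumℤ-map-*ʳ h s xs)) (sym (*-distribʳ-+ s (h x) _))

  sumℤ-map-zero : ∀ {A : Set} (xs : List A) → sumℤ (map (λ _ → 0ℤ) xs) ≡ 0ℤ
  sumℤ-map-zero []       = refl
  sumℤ-map-zero (x ∷ xs) = trans (+-identityˡ _) (sumℤ-map-zero xs)

  ≟-suc : ∀ m n → ⌊ suc m ℕ.≟ suc n ⌋ ≡ ⌊ m ℕ.≟ n ⌋
  ≟-suc m n with m ℕ.≟ n | suc m ℕ.≟ suc n
  ... | yes _   | yes _   = refl
  ... | no  _   | no  _   = refl
  ... | yes m≡n | no  m≢n = contradiction (cong suc m≡n) m≢n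
  ... | no  m≢n | yes m≡n = contradiction (ℕ.suc-injective m≡n) m≢n

  sumℤ-applyUpTo-zero : ∀ {g : ℕ → ℤ} → (∀ i → g i ≡ 0ℤ) → ∀ n → sumℤ (applyUpTo g n) ≡ 0ℤ
  sumℤ-applyUpTo-zero g≡0 zero    = refl
  sumℤ-applyUpTo-zero g≡0 (suc n) = trans (cong₂ _+_ (g≡0 0) (sumℤ-applyUpTo-zero (λ i → g≡0 (suc i)) n)) refl

  sum-diagonal : ∀ a x y →
    sumℤ (applyUpTo (λ i → iverson ⌊ x ℕ.≟ i ⌋ * iverson ⌊ y ℕ.≟ a ∸ i ⌋) (suc a))
      ≡ iverson ⌊ x ℕ.+ y ℕ.≟ a ⌋
  sum-diagonal a       zero    y = trans
    (cong₂ _+_ (*-identityˡ (iverson ⌊ y ℕ.≟ a ⌋)) (sumℤ-applyUpTo-zero (λ i → refl) a))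
    (+-identityʳ _)
  sum-diagonal zero    (suc x) y = refl
  sum-diagonal (suc a) (suc x) y = begin
    0ℤ + sumℤ (applyUpTo (λ i → iverson ⌊ suc x ℕ.≟ suc i ⌋ * iverson ⌊ y ℕ.≟ a ∸ i ⌋) (suc a))
      ≡⟨ +-identityˡ _ ⟩
    sumℤ (applyUpTo (λ i → iverson ⌊ suc x ℕ.≟ suc i ⌋ * iverson ⌊ y ℕ.≟ a ∸ i ⌋) (suc a))
      ≡⟨ cong sumℤ (applyUpTo-cong (λ i → cong (λ b → iverson b * iverson ⌊ y ℕ.≟ a ∸ i ⌋) (≟-suc x i))
           (suc a)) ⟩
    sumℤ (applyUpTo (λ i → iverson ⌊ x ℕ.≟ i ⌋ * iverson ⌊ y ℕ.≟ a ∸ i ⌋) (suc a))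
      ≡⟨ sum-diagonal a x y ⟩
    iverson ⌊ x ℕ.+ y ℕ.≟ a ⌋
      ≡⟨ cong iverson (sym (≟-suc (x ℕ.+ y) a)) ⟩
    iverson ⌊ suc x ℕ.+ y ℕ.≟ suc a ⌋ ∎
    where
    open ≡-Reasoning
    applyUpTo-cong : ∀ {f g : ℕ → ℤ} → (∀ i → f i ≡ g i) → ∀ n → applyUpTo f n ≡ applyUpTo g n
    applyUpTo-cong f≗g zero    = refl
    applyUpTo-cong f≗g (suc n) = cong₂ _∷_ (f≗g 0) (applyUpTo-cong (λ i → f≗g (suc i)) n)

  splits-indicator : ∀ α (L M : List ℕ) → length L ≡ length M →
    sumℤ (map (λ p → iverson ⌊ L ≟ᴸ proj₁ p ⌋ * iverson ⌊ M ≟ᴸ proj₂ p ⌋) (splits α))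
      ≡ iverson ⌊ zipWith ℕ._+_ L M ≟ᴸ α ⌋
  splits-indicator []      []      []      _ = refl
  splits-indicator []      (x ∷ L) (y ∷ M) _ = refl
  splits-indicator (a ∷ α) []      []      _ = trans
    (sumℤ-map-concatMap-map _ _ (splits α) (upTo (suc a)))
    (trans (sumℤ-map-cong (λ i → sumℤ-map-zero (splits α)) (upTo (suc a))) (sumℤ-map-zero (upTo (suc a))))
  splits-indicator (a ∷ α) (x ∷ L) (y ∷ M) eq = begin
    sumℤ (map (λ p → iverson ⌊ (x ∷ L) ≟ᴸ proj₁ p ⌋ * iverson ⌊ (y ∷ M) ≟ᴸ proj₂ p ⌋) (splits (a ∷ α)))
      ≡⟨ sumℤ-map-concatMap-map _ _ (splits α) (upTo (suc a)) ⟩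
    sumℤ (map (λ i → sumℤ (map (λ q → term i (proj₁ q) (proj₂ q)) (splits α))) (upTo (suc a)))
      ≡⟨ sumℤ-map-cong (λ i → sumℤ-map-cong (λ q → factor i (proj₁ q) (proj₂ q)) (splits α)) (upTo (suc a)) ⟩
    sumℤ (map (λ i → sumℤ (map (λ q → diag i * rest (proj₁ q) (proj₂ q)) (splits α))) (upTo (suc a)))
      ≡⟨ sumℤ-map-cong (λ i → sym (*-sumℤ-map (diag i) (λ q → rest (proj₁ q) (proj₂ q)) (splits α))) (upTo (suc a)) ⟩
    sumℤ (map (λ i → diag i * sumℤ (map (λ q → rest (proj₁ q) (proj₂ q)) (splits α))) (upTo (suc a)))
      ≡⟨ sumℤ-map-cong (λ i → cong (diag i *_) (splits-indicator α L M (ℕ.suc-injective eq))) (upTo (suc a)) ⟩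
    sumℤ (map (λ i → diag i * iverson ⌊ zipWith ℕ._+_ L M ≟ᴸ α ⌋) (upTo (suc a)))
      ≡⟨ sumℤ-map-*ʳ diag (iverson ⌊ zipWith ℕ._+_ L M ≟ᴸ α ⌋) (upTo (suc a)) ⟩
    sumℤ (map diag (upTo (suc a))) * iverson ⌊ zipWith ℕ._+_ L M ≟ᴸ α ⌋
      ≡⟨ cong (_* iverson ⌊ zipWith ℕ._+_ L M ≟ᴸ α ⌋) (trans (cong sumℤ (map-upTo diag (suc a))) (sum-diagonal a x y)) ⟩
    iverson ⌊ x ℕ.+ y ℕ.≟ a ⌋ * iverson ⌊ zipWith ℕ._+_ L M ≟ᴸ α ⌋
      ≡⟨ trans (cong iverson (≟ᴸ-∷ (x ℕ.+ y) a (zipWith ℕ._+_ L M) α))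
           (iverson-∧ ⌊ x ℕ.+ y ℕ.≟ a ⌋ ⌊ zipWith ℕ._+_ L M ≟ᴸ α ⌋) ⟨
    iverson ⌊ zipWith ℕ._+_ (x ∷ L) (y ∷ M) ≟ᴸ (a ∷ α) ⌋ ∎
    where
    open ≡-Reasoning
    term : ℕ → List ℕ → List ℕ → ℤ
    term i β γ = iverson ⌊ (x ∷ L) ≟ᴸ (i ∷ β) ⌋ * iverson ⌊ (y ∷ M) ≟ᴸ ((a ∸ i) ∷ γ) ⌋
    diag : ℕ → ℤ
    diag i = iverson ⌊ x ℕ.≟ i ⌋ * iverson ⌊ y ℕ.≟ a ∸ i ⌋
    rest : List ℕ → List ℕ → ℤ
    rest β γ = iverson ⌊ L ≟ᴸ β ⌋ * iverson ⌊ M ≟ᴸ γ ⌋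
    factor : ∀ i β γ → term i β γ ≡ diag i * rest β γ
    factor i β γ = begin
      term i β γ
        ≡⟨ cong₂ (λ b b' → iverson b * iverson b') (≟ᴸ-∷ x i L β) (≟ᴸ-∷ y (a ∸ i) M γ) ⟩
      iverson (⌊ x ℕ.≟ i ⌋ ∧ ⌊ L ≟ᴸ β ⌋) * iverson (⌊ y ℕ.≟ a ∸ i ⌋ ∧ ⌊ M ≟ᴸ γ ⌋)
        ≡⟨ cong₂ _*_ (iverson-∧ ⌊ x ℕ.≟ i ⌋ ⌊ L ≟ᴸ β ⌋) (iverson-∧ ⌊ y ℕ.≟ a ∸ i ⌋ ⌊ M ≟ᴸ γ ⌋) ⟩
      (iverson ⌊ x ℕ.≟ i ⌋ * iverson ⌊ L ≟ᴸ β ⌋) * (iverson ⌊ y ℕ.≟ a ∸ i ⌋ * iverson ⌊ M ≟ᴸ γ ⌋)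
        ≡⟨ *-interchange (iverson ⌊ x ℕ.≟ i ⌋) _ _ _ ⟩
      diag i * rest β γ ∎

  sumℤ-map-splits-cong : ∀ α {f g : List ℕ × List ℕ → ℤ} →
    (∀ β γ → length β ≡ length α → length γ ≡ length α → f (β , γ) ≡ g (β , γ)) →
    sumℤ (map f (splits α)) ≡ sumℤ (map g (splits α))
  sumℤ-map-splits-cong []      f≗g = cong (_+ 0ℤ) (f≗g [] [] refl refl)
  sumℤ-map-splits-cong (a ∷ α) {f} {g} f≗g = begin
    sumℤ (map f (splits (a ∷ α)))
      ≡⟨ sumℤ-map-concatMap-map f _ (splits α) (upTo (suc a)) ⟩
    sumℤ (map (λ i → sumℤ (map (λ q → f (i ∷ proj₁ q , (a ∸ i) ∷ proj₂ q)) (splits α))) (upTo (suc a)))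
      ≡⟨ sumℤ-map-cong (λ i → sumℤ-map-splits-cong α λ β γ |β| |γ| → f≗g _ _ (cong suc |β|) (cong suc |γ|))
           (upTo (suc a)) ⟩
    sumℤ (map (λ i → sumℤ (map (λ q → g (i ∷ proj₁ q , (a ∸ i) ∷ proj₂ q)) (splits α))) (upTo (suc a)))
      ≡⟨ sym (sumℤ-map-concatMap-map g _ (splits α) (upTo (suc a))) ⟩
    sumℤ (map g (splits (a ∷ α))) ∎
    where open ≡-Reasoning

  toList-⊞ : ∀ {k} (t t' : Vec ℕ k) → toList (t ⊞ t') ≡ zipWith ℕ._+_ (toList t) (toList t')
  toList-⊞ []      []        = refl
  toList-⊞ (x ∷ t) (x' ∷ t') = cong (x ℕ.+ x' ∷_) (toList-⊞ t t')

  module _ {m k : ℕ} (w : Vec (Fin k) m → ℤ) where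

    integrate-zero : integrate w (λ _ → 0ℤ) ≡ 0ℤ
    integrate-zero = sym (*-integrate w 0ℤ (λ _ → 0ℤ))

    integrate-sumℤ : ∀ {A : Set} (F : A → Vec ℕ k → ℤ) xs →
      integrate w (λ t → sumℤ (map (λ x → F x t) xs)) ≡ sumℤ (map (λ x → integrate w (F x)) xs)
    integrate-sumℤ F []       = integrate-zero
    integrate-sumℤ F (x ∷ xs) = trans (integrate-+ w (F x) (λ t → sumℤ (map (λ x → F x t) xs)))
      (cong (integrate w (F x) +_) (integrate-sumℤ F xs))

  module _ {m n k : ℕ} (w : Vec (Fin k) m → ℤ) (w' : Vec (Fin k) n → ℤ) where

    integrate-* : ∀ (F G : Vec ℕ k → ℤ) →
      integrate w F * integrate w' G ≡ integrate w (λ t → integrate w' (λ t' → F t * G t'))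
    integrate-* F G = trans (*-comm (integrate w F) (integrate w' G))
      (trans (*-integrate w (integrate w' G) F) (integrate-cong w λ t →
        trans (*-comm (integrate w' G) (F t)) (*-integrate w' (F t) G)))

  ⊗-congʳ : ∀ {f g : Series} (h : Series) → f ≈ g → f ⊗ h ≈ g ⊗ h
  ⊗-congʳ h f≈g α = sumℤ-map-cong (λ p → cong (_* h (proj₂ p)) (f≈g (proj₁ p))) (splits α)

  X-colourings-at : ∀ G α {k} → length α ≡ k → X G α ≡ colourings G {k} 𝟙[ α ]
  X-colourings-at G α refl = X-colourings G α

  X-⊗ : ∀ G H α →
    (X G ⊗ X H) α ≡ colourings G {length α} (λ t → colourings H (λ t' → 𝟙[ α ] (t ⊞ t')))
  X-⊗ G H α = begin
    (X G ⊗ X H) α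
      ≡⟨ sumℤ-map-splits-cong α (λ β γ |β| |γ| → cong₂ _*_ (X-colourings-at G β |β|) (X-colourings-at H γ |γ|)) ⟩
    sumℤ (map (λ p → colourings G 𝟙[ proj₁ p ] * colourings H 𝟙[ proj₂ p ]) (splits α))
      ≡⟨ sumℤ-map-cong (λ p → integrate-* wG wH 𝟙[ proj₁ p ] 𝟙[ proj₂ p ]) (splits α) ⟩
    sumℤ (map (λ p → colourings G (λ t → colourings H (λ t' → 𝟙[ proj₁ p ] t * 𝟙[ proj₂ p ] t'))) (splits α))
      ≡⟨ sym (integrate-sumℤ wG (λ p t → colourings H (λ t' → 𝟙[ proj₁ p ] t * 𝟙[ proj₂ p ] t')) (splits α)) ⟩
    colourings G (λ t → sumℤ (map (λ p → colourings H (λ t' → 𝟙[ proj₁ p ] t * 𝟙[ proj₂ p ] t')) (splits α)))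
      ≡⟨ integrate-cong wG (λ t →
           sym (integrate-sumℤ wH (λ p t' → 𝟙[ proj₁ p ] t * 𝟙[ proj₂ p ] t') (splits α))) ⟩
    colourings G (λ t → colourings H (λ t' → sumℤ (map (λ p → 𝟙[ proj₁ p ] t * 𝟙[ proj₂ p ] t') (splits α))))
      ≡⟨ integrate-cong wG (λ t → integrate-cong wH (λ t' → sumℤ-splits-𝟙 t t')) ⟩
    colourings G (λ t → colourings H (λ t' → 𝟙[ α ] (t ⊞ t'))) ∎
    where
    open ≡-Reasoning
    k : ℕ
    k = length α
    wG : Vec (Fin k) (Graph.size G) → ℤ
    wG = properWeight G
    wH : Vec (Fin k) (Graph.size H) → ℤ
    wH = properWeight H
    sumℤ-splits-𝟙 : ∀ (t t' : Vec ℕ k) →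
      sumℤ (map (λ p → 𝟙[ proj₁ p ] t * 𝟙[ proj₂ p ] t') (splits α)) ≡ 𝟙[ α ] (t ⊞ t')
    sumℤ-splits-𝟙 t t' = trans
      (splits-indicator α (toList t) (toList t') (trans (length-toList t) (sym (length-toList t'))))
      (cong (λ L → iverson ⌊ L ≟ᴸ α ⌋) (sym (toList-⊞ t t')))

module Properness where

  open import Data.Nat using (ℕ; suc; _+_)
  open import Data.Fin using (Fin; zero; suc; _≟_; splitAt; join; punchIn; punchOut)
  open import Data.Fin.Properties using (suc-injective; punchInᵢ≢i; punchIn-injective; punchIn-punchOut; splitAt-join; join-splitAt)
  open import Data.Vec using (Vec; _∷_; lookup; _++_; insertAt)
  open import Data.Vec.Properties using (lookup-splitAt; insertAt-lookup; insertAt-punchIn)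
  open import Data.List using (allFin)
  open import Data.List.Relation.Unary.All using (All; []; _∷_)
  open import Data.List.Relation.Unary.All.Properties using (tabulate⁺; tabulate⁻)
  open import Data.Bool using (Bool; true; false; T; not; _∧_; _∨_)
  open import Data.Bool.Properties using (T-∧; T-∨)
  open import Data.Maybe using (Maybe; just; nothing)
  import Data.Maybe as Maybe
  open import Data.Maybe.Properties using (just-injective)
  open import Data.Product using (_×_; _,_)
  open import Data.Sum using (_⊎_; inj₁; inj₂; [_,_]′)
  open import Data.Empty using (⊥-elim)
  open import Function using (_⇔_; mk⇔; Equivalence)
  open import Relation.Nullary using (¬_; yes; no; contradiction)
  open import Relation.Nullary.Decidable using (⌊_⌋; toWitness; fromWitness; toWitnessFalse; fromWitnessFalse)
  open import Relation.Binary.PropositionalEquality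
  open import Defs using (Graph; graph; adjacent; proper; allᵇ; Rooted; rooted; underlying; wedge; extend)
  open Equivalence using (to; from)
  open import Function.Properties.Equivalence using (⇔-setoid) renaming (sym to ⇔-sym)
  open import Data.Product.Function.NonDependent.Propositional using (_×-⇔_)
  import Relation.Binary.Reasoning.Setoid
  import Level
  module ⇔-Reasoning = Relation.Binary.Reasoning.Setoid (⇔-setoid Level.zero)

  T-not : ∀ {b} → ¬ T b → T (not b)
  T-not {true}  ¬b = ¬b _
  T-not {false} ¬b = _

  T-not⁻ : ∀ {b} → T (not b) → ¬ T b
  T-not⁻ {true} ()

  T⇔T⇒≡ : ∀ {a b} → T a ⇔ T b → a ≡ b
  T⇔T⇒≡ {true}  {true}  _    = refl
  T⇔T⇒≡ {true}  {false} a⇔b = ⊥-elim (to a⇔b _)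
  T⇔T⇒≡ {false} {true}  a⇔b = ⊥-elim (from a⇔b _)
  T⇔T⇒≡ {false} {false} _    = refl

  T-allᵇ : ∀ {A : Set} (p : A → Bool) xs → T (allᵇ p xs) ⇔ All (λ x → T (p x)) xs
  T-allᵇ p Data.List.[]         = mk⇔ (λ _ → []) (λ _ → _)
  T-allᵇ p (x Data.List.∷ xs) = mk⇔
    (λ h → let (px , pxs) = to T-∧ h in px ∷ to (T-allᵇ p xs) pxs)
    (λ { (px ∷ pxs) → from T-∧ (px , from (T-allᵇ p xs) pxs) })

  T-allᵇ-allFin : ∀ {n} (p : Fin n → Bool) → T (allᵇ p (allFin n)) ⇔ (∀ i → T (p i))
  T-allᵇ-allFin p = mk⇔ (λ h → tabulate⁻ (to (T-allᵇ p _) h)) (λ h → from (T-allᵇ p _) (tabulate⁺ h))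

  ProperFor : ∀ {n k} → (Fin n → Fin n → Bool) → (Fin n → Fin k) → Set
  ProperFor e κ = ∀ i j → T (e i j) → i ≢ j → κ i ≢ κ j

  T-adjacent : ∀ {n} (e : Fin n → Fin n → Bool) i j →
    T (adjacent (graph n e) i j) ⇔ (i ≢ j × (T (e i j) ⊎ T (e j i)))
  T-adjacent e i j = mk⇔
    (λ h → let (i≢j , e∨) = to (T-∧ {not ⌊ i ≟ j ⌋}) h in toWitnessFalse i≢j , to (T-∨ {e i j}) e∨)
    (λ (i≢j , e⊎) → from (T-∧ {not ⌊ i ≟ j ⌋}) (fromWitnessFalse i≢j , from (T-∨ {e i j}) e⊎))

  T-proper : ∀ {n k} (e : Fin n → Fin n → Bool) (κ : Fin n → Fin k) → T (proper (graph n e) κ) ⇔ ProperFor e κ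
  T-proper {n} e κ = mk⇔
    (λ h i j eij i≢j κi≡κj → T-not⁻ (to (T-allᵇ-allFin _) (to (T-allᵇ-allFin _) h i) j)
      (from (T-∧ {adjacent G i j}) (from (T-adjacent e i j) (i≢j , inj₁ eij) , fromWitness κi≡κj)))
    (λ h → from (T-allᵇ-allFin _) λ i → from (T-allᵇ-allFin _) λ j → T-not λ t →
      let (adj , κi≡κj) = to (T-∧ {adjacent G i j}) t
          (i≢j , e⊎) = to (T-adjacent e i j) adj
      in [ (λ eij → h i j eij i≢j (toWitness κi≡κj))
         , (λ eji → h j i eji (λ j≡i → i≢j (sym j≡i)) (sym (toWitness κi≡κj))) ]′ e⊎)
    where
    G : Graph
    G = graph n e

  module _ {n k : ℕ} {κ : Fin n → Fin k} where

    ProperFor-≗ : ∀ {e e' : Fin n → Fin n → Bool} → (∀ i j → e i j ≡ e' i j) → ProperFor e κ ⇔ ProperFor e' κ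
    ProperFor-≗ e≗e' = mk⇔ (λ h i j e'ij → h i j (subst T (sym (e≗e' i j)) e'ij))
                           (λ h i j eij → h i j (subst T (e≗e' i j) eij))

    ProperFor-∨ : ∀ (e f : Fin n → Fin n → Bool) →
      ProperFor (λ i j → e i j ∨ f i j) κ ⇔ (ProperFor e κ × ProperFor f κ)
    ProperFor-∨ e f = mk⇔
      (λ h → (λ i j eij → h i j (from (T-∨ {e i j}) (inj₁ eij))) , (λ i j fij → h i j (from (T-∨ {e i j}) (inj₂ fij))))
      (λ (he , hf) i j e∨f → [ he i j , hf i j ]′ (to (T-∨ {e i j}) e∨f))

  -- A copy of the helper `both` local to `wedge`, so that `edge-wedge` below holds by computation.
  onBoth : ∀ {n} → (Fin n → Fin n → Bool) → Maybe (Fin n) → Maybe (Fin n) → Bool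
  onBoth e (just i) (just j) = e i j
  onBoth e _        _        = false

  module Pullback {N n k : ℕ} (p : Fin N → Maybe (Fin n)) (ι : Fin n → Fin N)
    (p∘ι : ∀ i → p (ι i) ≡ just i)
    (p-injective : ∀ {x y i} → p x ≡ just i → p y ≡ just i → x ≡ y)
    {κ : Fin N → Fin k} {κ' : Fin n → Fin k} (compatible : ∀ {x i} → p x ≡ just i → κ x ≡ κ' i) where

    ProperFor-pullback : ∀ (e : Fin n → Fin n → Bool) → ProperFor (λ x y → onBoth e (p x) (p y)) κ ⇔ ProperFor e κ'
    ProperFor-pullback e = mk⇔ fromPullback toPullback
      where
      fromPullback : ProperFor (λ x y → onBoth e (p x) (p y)) κ → ProperFor e κ'
      fromPullback h i j eij i≢j κ'i≡κ'j = h (ι i) (ι j)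
        (subst T (sym (cong₂ (onBoth e) (p∘ι i) (p∘ι j))) eij)
        (λ ιi≡ιj → i≢j (just-injective (trans (sym (p∘ι i)) (trans (cong p ιi≡ιj) (p∘ι j)))))
        (trans (compatible (p∘ι i)) (trans κ'i≡κ'j (sym (compatible (p∘ι j)))))
      toPullback : ProperFor e κ' → ProperFor (λ x y → onBoth e (p x) (p y)) κ
      toPullback h x y with p x in px | p y in py
      ... | just i | just j = λ eij x≢y κx≡κy →
        h i j eij (λ { refl → x≢y (p-injective px py) }) (trans (sym (compatible px)) (trans κx≡κy (compatible py)))

  -- Vertex 0 of `wedge` is the common root; vertex suc y is the non-root vertex punchIn r p of the
  -- first graph if splitAt a y = inj₁ p, and punchIn s q of the second if it is inj₂ q. `sel`
  -- selects one of the two sides and `restrict` is the resulting partial map onto that side.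
  module WedgeSide {a b m : ℕ} (sel : Fin a ⊎ Fin b → Maybe (Fin m)) (σ : Fin m → Fin a ⊎ Fin b)
    (sel∘σ : ∀ q → sel (σ q) ≡ just q)
    (sel-injective : ∀ {u u' q} → sel u ≡ just q → sel u' ≡ just q → u ≡ u')
    (r : Fin (suc m)) where

    restrict : Fin (suc (a + b)) → Maybe (Fin (suc m))
    restrict zero    = just r
    restrict (suc y) = Maybe.map (punchIn r) (sel (splitAt a y))

    section : Fin (suc m) → Fin (suc (a + b))
    section i with r ≟ i
    ... | yes _   = zero
    ... | no  r≢i = suc (join a b (σ (punchOut r≢i)))

    restrict∘section : ∀ i → restrict (section i) ≡ just i
    restrict∘section i with r ≟ i
    ... | yes r≡i = cong just r≡i
    ... | no  r≢i rewrite splitAt-join a b (σ (punchOut r≢i)) | sel∘σ (punchOut r≢i) =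
      cong just (punchIn-punchOut r≢i)

    restrict-injective : ∀ {x y i} → restrict x ≡ just i → restrict y ≡ just i → x ≡ y
    restrict-injective {zero}  {zero}  _  _  = refl
    restrict-injective {zero}  {suc y} rx ry with sel (splitAt a y)
    ... | just q = contradiction (just-injective (trans ry (sym rx))) (punchInᵢ≢i r q)
    restrict-injective {suc x} {zero}  rx ry with sel (splitAt a x)
    ... | just q = contradiction (just-injective (trans rx (sym ry))) (punchInᵢ≢i r q)
    restrict-injective {suc x} {suc y} rx ry with sel (splitAt a x) in sx | sel (splitAt a y) in sy
    ... | just q | just q' with refl ← punchIn-injective r q q' (just-injective (trans rx (sym ry))) =
      cong suc (trans (sym (join-splitAt a b x)) (trans (cong (join a b) (sel-injective sx sy)) (join-splitAt a b y)))

    restrict-lookup : ∀ {k} (c : Fin k) (v₁ : Vec (Fin k) a) (v₂ : Vec (Fin k) b) (v : Vec (Fin k) m) →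
      (∀ {u q} → sel u ≡ just q → [ lookup v₁ , lookup v₂ ]′ u ≡ lookup v q) →
      ∀ {x i} → restrict x ≡ just i → lookup (c ∷ (v₁ ++ v₂)) x ≡ lookup (insertAt v r c) i
    restrict-lookup c v₁ v₂ v sel-lookup {zero} refl = sym (insertAt-lookup v r c)
    restrict-lookup c v₁ v₂ v sel-lookup {suc y} rx with sel (splitAt a y) in sy
    restrict-lookup c v₁ v₂ v sel-lookup {suc y} refl | just q =
      trans (lookup-splitAt a v₁ v₂ y) (trans (sel-lookup sy) (sym (insertAt-punchIn v r c q)))

  module _ (a : ℕ) (e : Fin (suc a) → Fin (suc a) → Bool) (r : Fin (suc a))
           (b : ℕ) (f : Fin (suc b) → Fin (suc b) → Bool) (s : Fin (suc b)) where

    private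
      selˡ : Fin a ⊎ Fin b → Maybe (Fin a)
      selˡ = [ just , (λ _ → nothing) ]′

      selʳ : Fin a ⊎ Fin b → Maybe (Fin b)
      selʳ = [ (λ _ → nothing) , just ]′

      selˡ-injective : ∀ {u u' q} → selˡ u ≡ just q → selˡ u' ≡ just q → u ≡ u'
      selˡ-injective {inj₁ _} {inj₁ _} refl refl = refl

      selʳ-injective : ∀ {u u' q} → selʳ u ≡ just q → selʳ u' ≡ just q → u ≡ u'
      selʳ-injective {inj₂ _} {inj₂ _} refl refl = refl

      module L = WedgeSide selˡ inj₁ (λ _ → refl) selˡ-injective r
      module R = WedgeSide selʳ inj₂ (λ _ → refl) selʳ-injective s

      W : Rooted
      W = wedge (rooted a e r) (rooted b f s)

      edge-wedge : ∀ x y → Graph.edge (underlying W) x y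
        ≡ onBoth e (L.restrict x) (L.restrict y) ∨ onBoth f (R.restrict x) (R.restrict y)
      edge-wedge zero    zero    = refl
      edge-wedge zero    (suc y) with splitAt a y
      ... | inj₁ _ = refl
      ... | inj₂ _ = refl
      edge-wedge (suc x) zero    with splitAt a x
      ... | inj₁ _ = refl
      ... | inj₂ _ = refl
      edge-wedge (suc x) (suc y) with splitAt a x | splitAt a y
      ... | inj₁ _ | inj₁ _ = refl
      ... | inj₁ _ | inj₂ _ = refl
      ... | inj₂ _ | inj₁ _ = refl
      ... | inj₂ _ | inj₂ _ = refl

    proper-wedge : ∀ {k} (c : Fin k) (v₁ : Vec (Fin k) a) (v₂ : Vec (Fin k) b) →
      proper (underlying (wedge (rooted a e r) (rooted b f s))) (lookup (c ∷ (v₁ ++ v₂)))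
        ≡ proper (graph (suc a) e) (lookup (insertAt v₁ r c)) ∧ proper (graph (suc b) f) (lookup (insertAt v₂ s c))
    proper-wedge {k} c v₁ v₂ = T⇔T⇒≡ (begin
      T (proper (underlying W) κ)
        ≈⟨ T-proper (Graph.edge (underlying W)) κ ⟩
      ProperFor (Graph.edge (underlying W)) κ
        ≈⟨ ProperFor-≗ edge-wedge ⟩
      ProperFor (λ x y → onBoth e (L.restrict x) (L.restrict y) ∨ onBoth f (R.restrict x) (R.restrict y)) κ
        ≈⟨ ProperFor-∨ _ _ ⟩
      (ProperFor (λ x y → onBoth e (L.restrict x) (L.restrict y)) κ
        × ProperFor (λ x y → onBoth f (R.restrict x) (R.restrict y)) κ)
        ≈⟨ Pullback.ProperFor-pullback L.restrict L.section L.restrict∘section L.restrict-injective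
             (λ {x} → L.restrict-lookup c v₁ v₂ v₁ (λ { {inj₁ _} refl → refl }) {x}) e
           ×-⇔
           Pullback.ProperFor-pullback R.restrict R.section R.restrict∘section R.restrict-injective
             (λ {x} → R.restrict-lookup c v₁ v₂ v₂ (λ { {inj₂ _} refl → refl }) {x}) f ⟩
      (ProperFor e κ₁ × ProperFor f κ₂)
        ≈⟨ ⇔-sym (T-proper e κ₁ ×-⇔ T-proper f κ₂) ⟩
      (T (proper (graph (suc a) e) κ₁) × T (proper (graph (suc b) f) κ₂))
        ≈⟨ ⇔-sym T-∧ ⟩
      T (proper (graph (suc a) e) κ₁ ∧ proper (graph (suc b) f) κ₂) ∎)
      where
      open ⇔-Reasoning
      κ : Fin (suc (a + b)) → Fin k
      κ = lookup (c ∷ (v₁ ++ v₂))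
      κ₁ : Fin (suc a) → Fin k
      κ₁ = lookup (insertAt v₁ r c)
      κ₂ : Fin (suc b) → Fin k
      κ₂ = lookup (insertAt v₂ s c)

  module _ (n : ℕ) (e : Fin (suc n) → Fin (suc n) → Bool) (r : Fin (suc n))
           {k : ℕ} (c : Fin k) (u : Vec (Fin k) (suc n)) where

    private
      E : Fin (suc (suc n)) → Fin (suc (suc n)) → Bool
      E = Graph.edge (underlying (extend (rooted n e r)))

      ProperFor-extend : ProperFor E (lookup (c ∷ u)) ⇔ (c ≢ lookup u r × ProperFor e (lookup u))
      ProperFor-extend = mk⇔
        (λ h → (λ c≡ → h zero (suc r) (fromWitness refl) (λ ()) c≡)
             , (λ i j eij i≢j → h (suc i) (suc j) eij (λ si≡sj → i≢j (suc-injective si≡sj))))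
        (λ (c≢ , h) → λ where
          zero    zero    _    0≢0 → contradiction refl 0≢0
          zero    (suc j) j≡r  _   → λ c≡ → c≢ (trans c≡ (cong (lookup u) (toWitness j≡r)))
          (suc i) zero    i≡r  _   → λ ≡c → c≢ (trans (sym ≡c) (cong (lookup u) (toWitness i≡r)))
          (suc i) (suc j) eij i≢j  → h i j eij (λ i≡j → i≢j (cong suc i≡j)))

    proper-extend : proper (underlying (extend (rooted n e r))) (lookup (c ∷ u))
      ≡ not ⌊ c ≟ lookup u r ⌋ ∧ proper (graph (suc n) e) (lookup u)
    proper-extend = T⇔T⇒≡ (begin
      T (proper (underlying (extend (rooted n e r))) (lookup (c ∷ u)))
        ≈⟨ T-proper E (lookup (c ∷ u)) ⟩
      ProperFor E (lookup (c ∷ u))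
        ≈⟨ ProperFor-extend ⟩
      (c ≢ lookup u r × ProperFor e (lookup u))
        ≈⟨ mk⇔ fromWitnessFalse toWitnessFalse ×-⇔ ⇔-sym (T-proper e (lookup u)) ⟩
      (T (not ⌊ c ≟ lookup u r ⌋) × T (proper (graph (suc n) e) (lookup u)))
        ≈⟨ ⇔-sym T-∧ ⟩
      T (not ⌊ c ≟ lookup u r ⌋ ∧ proper (graph (suc n) e) (lookup u)) ∎)
      where open ⇔-Reasoning

module RootedColourings where

  open import Data.Nat using (ℕ; suc)
  open import Data.Fin using (Fin; _≟_)
  open import Data.Vec using (Vec; lookup; _++_; insertAt)
  open import Data.Vec.Properties using (insertAt-lookup)
  open import Data.Bool using (not; _∧_)
  open import Data.Integer using (ℤ; _*_)
  open import Data.Integer.Properties using (*-assoc; *-identityˡ)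
  open import Relation.Nullary using (yes; no; contradiction)
  open import Relation.Nullary.Decidable using (⌊_⌋)
  open import Relation.Binary.PropositionalEquality
  open import Defs using (Rooted; rooted; graph; underlying; proper; wedge; extend; K1)
  open Sums
  open ColourCounts
  open Colourings
  open Properness

  apart : ∀ {k} → Fin k → Fin k → ℤ
  apart c d = iverson (not ⌊ c ≟ d ⌋)

  apart-sym : ∀ {k} (c d : Fin k) → apart c d ≡ apart d c
  apart-sym c d with c ≟ d | d ≟ c
  ... | yes _   | yes _   = refl
  ... | no  _   | no  _   = refl
  ... | yes c≡d | no  d≢c = contradiction (sym c≡d) d≢c
  ... | no  c≢d | yes d≡c = contradiction (sym d≡c) c≢d

  rootedWeight : (R : Rooted) {k : ℕ} → Fin k → Vec (Fin k) (Rooted.n R) → ℤ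
  rootedWeight R c v =
    iverson (proper (graph (suc (Rooted.n R)) (Rooted.edge R)) (lookup (insertAt v (Rooted.root R) c)))

  rootedColourings : (R : Rooted) {k : ℕ} → Fin k → (Vec ℕ k → ℤ) → ℤ
  rootedColourings R c = integrate (rootedWeight R c)

  module _ {k : ℕ} where

    rootedColourings-cong : ∀ R (c : Fin k) {F G : Vec ℕ k → ℤ} → (∀ t → F t ≡ G t) →
      rootedColourings R c F ≡ rootedColourings R c G
    rootedColourings-cong R c = integrate-cong (rootedWeight R c)

    rootedColourings-sum : ∀ R (c : Fin k) (F : Fin k → Vec ℕ k → ℤ) →
      rootedColourings R c (λ t → ∑[ d < k ] F d t) ≡ ∑[ d < k ] rootedColourings R c (F d)
    rootedColourings-sum R c = integrate-sum (rootedWeight R c)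

    rootedColourings-linear : ∀ R (c : Fin k) (s : Fin k → ℤ) (F : Fin k → Vec ℕ k → ℤ) →
      rootedColourings R c (λ t → ∑[ d < k ] (s d * F d t)) ≡ ∑[ d < k ] (s d * rootedColourings R c (F d))
    rootedColourings-linear R c s F = trans (rootedColourings-sum R c (λ d t → s d * F d t))
      (sum-cong-≗ λ d → sym (*-integrate (rootedWeight R c) (s d) (F d)))

    colourings-underlying : ∀ R (F : Vec ℕ k → ℤ) →
      colourings (underlying R) F ≡ ∑[ c < k ] rootedColourings R c (λ t → F (δ c ⊞ t))
    colourings-underlying (rooted n e r) F = trans
      (sumVec-insertAt n r (λ u → properWeight (graph (suc n) e) u * F (colourCount u)))
      (sum-cong-≗ λ c → sumVec-cong n λ v →
        cong (λ t → rootedWeight (rooted n e r) c v * F t) (colourCount-insertAt v r c))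

    rootedColourings-wedge : ∀ R S (c : Fin k) (F : Vec ℕ k → ℤ) →
      rootedColourings (wedge R S) c F ≡ rootedColourings R c (λ t → rootedColourings S c (λ t' → F (t ⊞ t')))
    rootedColourings-wedge (rooted a e r) (rooted b f s) c F = trans
      (sumVec-++ a b (λ u → rootedWeight (wedge (rooted a e r) (rooted b f s)) c u * F (colourCount u)))
      (sumVec-cong a λ v₁ → trans (sumVec-cong b λ v₂ → split v₁ v₂)
        (sym (*-distribˡ-sumVec b (wL v₁) (λ v₂ → wR v₂ * F (colourCount v₁ ⊞ colourCount v₂)))))
      where
      wL : Vec (Fin k) a → ℤ
      wL = rootedWeight (rooted a e r) c
      wR : Vec (Fin k) b → ℤ
      wR = rootedWeight (rooted b f s) c
      split : ∀ v₁ v₂ → rootedWeight (wedge (rooted a e r) (rooted b f s)) c (v₁ ++ v₂) * F (colourCount (v₁ ++ v₂))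
        ≡ wL v₁ * (wR v₂ * F (colourCount v₁ ⊞ colourCount v₂))
      split v₁ v₂ = begin
        rootedWeight (wedge (rooted a e r) (rooted b f s)) c (v₁ ++ v₂) * F (colourCount (v₁ ++ v₂))
          ≡⟨ cong₂ (λ b t → iverson b * F t) (proper-wedge a e r b f s c v₁ v₂) (colourCount-++ v₁ v₂) ⟩
        iverson (proper (graph (suc a) e) κ₁ ∧ proper (graph (suc b) f) κ₂) * F (colourCount v₁ ⊞ colourCount v₂)
          ≡⟨ cong (_* F (colourCount v₁ ⊞ colourCount v₂)) (iverson-∧ (proper (graph (suc a) e) κ₁) _) ⟩
        (wL v₁ * wR v₂) * F (colourCount v₁ ⊞ colourCount v₂)
          ≡⟨ *-assoc (wL v₁) (wR v₂) _ ⟩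
        wL v₁ * (wR v₂ * F (colourCount v₁ ⊞ colourCount v₂)) ∎
        where
        open ≡-Reasoning
        κ₁ : Fin (suc a) → Fin k
        κ₁ = lookup (insertAt v₁ r c)
        κ₂ : Fin (suc b) → Fin k
        κ₂ = lookup (insertAt v₂ s c)

    rootedColourings-extend : ∀ R (c : Fin k) (F : Vec ℕ k → ℤ) →
      rootedColourings (extend R) c F ≡ ∑[ d < k ] (apart c d * rootedColourings R d (λ t → F (δ d ⊞ t)))
    rootedColourings-extend (rooted n e r) c F = trans
      (sumVec-insertAt n r (λ u → rootedWeight (extend (rooted n e r)) c u * F (colourCount u)))
      (sum-cong-≗ λ d → trans (sumVec-cong n λ v → split d v)
        (sym (*-distribˡ-sumVec n (apart c d) (λ v → rootedWeight (rooted n e r) d v * F (δ d ⊞ colourCount v)))))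
      where
      split : ∀ d v → rootedWeight (extend (rooted n e r)) c (insertAt v r d) * F (colourCount (insertAt v r d))
        ≡ apart c d * (rootedWeight (rooted n e r) d v * F (δ d ⊞ colourCount v))
      split d v = begin
        rootedWeight (extend (rooted n e r)) c (insertAt v r d) * F (colourCount (insertAt v r d))
          ≡⟨ cong₂ (λ b t → iverson b * F t) (proper-extend n e r c (insertAt v r d)) (colourCount-insertAt v r d) ⟩
        iverson (not ⌊ c ≟ κ r ⌋ ∧ proper (graph (suc n) e) κ) * F (δ d ⊞ colourCount v)
          ≡⟨ cong (λ x → iverson (not ⌊ c ≟ x ⌋ ∧ proper (graph (suc n) e) κ) * F (δ d ⊞ colourCount v))
               (insertAt-lookup v r d) ⟩
        iverson (not ⌊ c ≟ d ⌋ ∧ proper (graph (suc n) e) κ) * F (δ d ⊞ colourCount v)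
          ≡⟨ cong (_* F (δ d ⊞ colourCount v)) (iverson-∧ (not ⌊ c ≟ d ⌋) _) ⟩
        (apart c d * rootedWeight (rooted n e r) d v) * F (δ d ⊞ colourCount v)
          ≡⟨ *-assoc (apart c d) _ _ ⟩
        apart c d * (rootedWeight (rooted n e r) d v * F (δ d ⊞ colourCount v)) ∎
        where
        open ≡-Reasoning
        κ : Fin (suc n) → Fin k
        κ = lookup (insertAt v r d)

    rootedColourings-K1 : ∀ (c : Fin k) (F : Vec ℕ k → ℤ) → rootedColourings K1 c F ≡ F 0̄
    rootedColourings-K1 c F = *-identityˡ (F 0̄)

    rootedColourings-wedge-extend : ∀ R S (c : Fin k) (F : Vec ℕ k → ℤ) →
      rootedColourings (wedge (extend R) S) c F
        ≡ ∑[ d < k ] (apart c d * rootedColourings R d (λ t → rootedColourings S c (λ t' → F ((δ d ⊞ t) ⊞ t'))))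
    rootedColourings-wedge-extend R S c F = trans (rootedColourings-wedge (extend R) S c F)
      (rootedColourings-extend R c (λ t → rootedColourings S c (λ t' → F (t ⊞ t'))))

module Sliding where

  open import Data.Nat using (ℕ; zero; suc; _+_)
  open import Data.Fin using (Fin)
  open import Data.Vec using (Vec)
  open import Data.List using (length)
  open import Data.Integer using (ℤ; _*_)
  open import Relation.Binary.PropositionalEquality
  open import Defs using (Rooted; underlying; wedge; extend; extendN; X; _≈_)
  open Sums
  open ColourCounts
  open Colourings
  open RootedColourings

  module _ {k : ℕ} where
    open import Algebra.Solver.CommutativeMonoid (⊞-0̄-commutativeMonoid k) using (solve; _⊜_; _⊕_)

    private
      ρ : Rooted → Fin k → (Vec ℕ k → ℤ) → ℤ
      ρ R = rootedColourings R

    joined : (R S : Rooted) → (Vec ℕ k → ℤ) → ℤ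
    joined R S F = ∑[ a < k ] ∑[ c < k ] (apart a c * ρ R a (λ tR → ρ S c (λ tS → F (δ a ⊞ δ c ⊞ tR ⊞ tS))))

    colourings-wedge-extendˡ : ∀ R S (F : Vec ℕ k → ℤ) →
      colourings (underlying (wedge (extend R) S)) F ≡ joined R S F
    colourings-wedge-extendˡ R S F = begin
      colourings (underlying (wedge (extend R) S)) F
        ≡⟨ colourings-underlying (wedge (extend R) S) F ⟩
      ∑[ c < k ] ρ (wedge (extend R) S) c (λ t → F (δ c ⊞ t))
        ≡⟨ sum-cong-≗ (λ c → rootedColourings-wedge-extend R S c (λ t → F (δ c ⊞ t))) ⟩
      ∑[ c < k ] ∑[ a < k ] (apart c a * ρ R a (λ tR → ρ S c (λ tS → F (δ c ⊞ (δ a ⊞ tR) ⊞ tS))))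
        ≡⟨ sum-comm (λ c a → apart c a * ρ R a (λ tR → ρ S c (λ tS → F (δ c ⊞ (δ a ⊞ tR) ⊞ tS)))) ⟩
      ∑[ a < k ] ∑[ c < k ] (apart c a * ρ R a (λ tR → ρ S c (λ tS → F (δ c ⊞ (δ a ⊞ tR) ⊞ tS))))
        ≡⟨ sum-cong-≗ (λ a → sum-cong-≗ λ c → cong₂ _*_ (apart-sym c a)
             (rootedColourings-cong R a λ tR → rootedColourings-cong S c λ tS → cong F (reorder (δ c) (δ a) tR tS))) ⟩
      joined R S F ∎
      where
      open ≡-Reasoning
      reorder : ∀ c a tR tS → c ⊞ (a ⊞ tR) ⊞ tS ≡ a ⊞ c ⊞ tR ⊞ tS
      reorder = solve 4 (λ c a tR tS → (c ⊕ ((a ⊕ tR) ⊕ tS)) ⊜ (a ⊕ (c ⊕ (tR ⊕ tS)))) refl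

    colourings-wedge-extendʳ : ∀ R S (F : Vec ℕ k → ℤ) →
      colourings (underlying (wedge R (extend S))) F ≡ joined R S F
    colourings-wedge-extendʳ R S F = begin
      colourings (underlying (wedge R (extend S))) F
        ≡⟨ colourings-underlying (wedge R (extend S)) F ⟩
      ∑[ a < k ] ρ (wedge R (extend S)) a (λ t → F (δ a ⊞ t))
        ≡⟨ sum-cong-≗ (λ a → trans (rootedColourings-wedge R (extend S) a (λ t → F (δ a ⊞ t)))
             (rootedColourings-cong R a λ tR → rootedColourings-extend S a (λ t → F (δ a ⊞ tR ⊞ t)))) ⟩
      ∑[ a < k ] ρ R a (λ tR → ∑[ c < k ] (apart a c * ρ S c (λ tS → F (δ a ⊞ tR ⊞ δ c ⊞ tS))))
        ≡⟨ sum-cong-≗ (λ a →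
             rootedColourings-linear R a (apart a) (λ c tR → ρ S c (λ tS → F (δ a ⊞ tR ⊞ δ c ⊞ tS)))) ⟩
      ∑[ a < k ] ∑[ c < k ] (apart a c * ρ R a (λ tR → ρ S c (λ tS → F (δ a ⊞ tR ⊞ δ c ⊞ tS))))
        ≡⟨ sum-cong-≗ (λ a → sum-cong-≗ λ c → cong (apart a c *_)
             (rootedColourings-cong R a λ tR → rootedColourings-cong S c λ tS → cong F (reorder (δ a) (δ c) tR tS))) ⟩
      joined R S F ∎
      where
      open ≡-Reasoning
      reorder : ∀ a c tR tS → a ⊞ tR ⊞ c ⊞ tS ≡ a ⊞ c ⊞ tR ⊞ tS
      reorder = solve 4 (λ a c tR tS → (a ⊕ (tR ⊕ (c ⊕ tS))) ⊜ (a ⊕ (c ⊕ (tR ⊕ tS)))) refl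

    colourings-slide : ∀ R S (F : Vec ℕ k → ℤ) →
      colourings (underlying (wedge (extend R) S)) F ≡ colourings (underlying (wedge R (extend S))) F
    colourings-slide R S F = trans (colourings-wedge-extendˡ R S F) (sym (colourings-wedge-extendʳ R S F))

  extendN-extend : ∀ i S → extendN i (extend S) ≡ extend (extendN i S)
  extendN-extend zero    S = refl
  extendN-extend (suc i) S = cong extend (extendN-extend i S)

  X-slide : ∀ i m R S →
    X (underlying (wedge (extendN (i + m) R) S)) ≈ X (underlying (wedge (extendN m R) (extendN i S)))
  X-slide zero    m R S α = refl
  X-slide (suc i) m R S α = begin
    X (underlying (wedge (extend (extendN (i + m) R)) S)) α
      ≡⟨ X-colourings (underlying (wedge (extend (extendN (i + m) R)) S)) α ⟩
    colourings (underlying (wedge (extend (extendN (i + m) R)) S)) {length α} 𝟙[ α ]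
      ≡⟨ colourings-slide {length α} (extendN (i + m) R) S 𝟙[ α ] ⟩
    colourings (underlying (wedge (extendN (i + m) R) (extend S))) {length α} 𝟙[ α ]
      ≡⟨ X-colourings (underlying (wedge (extendN (i + m) R) (extend S))) α ⟨
    X (underlying (wedge (extendN (i + m) R) (extend S))) α
      ≡⟨ X-slide i m R (extend S) α ⟩
    X (underlying (wedge (extendN m R) (extendN i (extend S)))) α
      ≡⟨ cong (λ S′ → X (underlying (wedge (extendN m R) S′)) α) (extendN-extend i S) ⟩
    X (underlying (wedge (extendN m R) (extend (extendN i S)))) α ∎
    where open ≡-Reasoning

module SpiderIdentity where

  open import Data.Nat using (ℕ)
  open import Data.Fin using (Fin)
  open import Data.Vec using (Vec)
  open import Data.List using (List; length)
  open import Data.Fin using (_≟_)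
  open import Data.Integer using (ℤ; _+_; _*_; _-_; -_; 0ℤ)
  open import Data.Integer.Properties using (*-assoc; *-distribʳ-+; +-identityʳ; +-inverseʳ; +-assoc)
  open import Relation.Nullary using (yes; no; contradiction)
  open import Relation.Binary.PropositionalEquality using (_≡_; refl; sym; trans; cong; cong₂; module ≡-Reasoning)
  open import Defs using (Rooted; underlying; wedge; extend; K1; X; _⊗_)
  open Sums
  open ColourCounts
  open Colourings
  open SeriesProduct using (X-⊗)
  open RootedColourings

  x+w≡y+z⇒x≡y+z-w : ∀ {x y z w : ℤ} → x + w ≡ y + z → x ≡ y + z - w
  x+w≡y+z⇒x≡y+z-w {x} {y} {z} {w} eq = begin
    x             ≡⟨ +-identityʳ x ⟨
    x + 0ℤ        ≡⟨ cong (x +_) (+-inverseʳ w) ⟨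
    x + (w - w)   ≡⟨ +-assoc x w (- w) ⟨
    x + w - w     ≡⟨ cong (_- w) eq ⟩
    y + z - w     ∎
    where open ≡-Reasoning

  apart-triangle : ∀ {k} (a d b : Fin k) → apart b a * apart b d + apart a d ≡ apart a d * apart a b + apart b d
  apart-triangle a d b rewrite apart-sym b a with a ≟ b | a ≟ d | b ≟ d
  ... | yes _   | yes _   | yes _   = refl
  ... | yes a≡b | yes a≡d | no  b≢d = contradiction (trans (sym a≡b) a≡d) b≢d
  ... | yes a≡b | no  a≢d | yes b≡d = contradiction (trans a≡b b≡d) a≢d
  ... | yes _   | no  _   | no  _   = refl
  ... | no  a≢b | yes a≡d | yes b≡d = contradiction (trans a≡d (sym b≡d)) a≢b
  ... | no  _   | yes _   | no  _   = refl
  ... | no  _   | no  _   | yes _   = refl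
  ... | no  _   | no  _   | no  _   = refl

  module _ (α : List ℕ) (E A H : Rooted) where

    private
      k : ℕ
      k = length α
      ρ : Rooted → Fin k → (Vec ℕ k → ℤ) → ℤ
      ρ R = rootedColourings R

      𝟙α : Vec ℕ k → ℤ
      𝟙α = 𝟙[ α ]

    open import Algebra.Solver.CommutativeMonoid (⊞-0̄-commutativeMonoid k) using (solve; _⊜_; _⊕_; id)

    ρ² : Fin k → Fin k → (Vec ℕ k → Vec ℕ k → Vec ℕ k) → ℤ
    ρ² d b f = ρ A d (λ tA → ρ H b (λ tH → 𝟙α (f tA tH)))

    ρ³ : Fin k → Fin k → Fin k → (Vec ℕ k → Vec ℕ k → Vec ℕ k → Vec ℕ k) → ℤ
    ρ³ a d b f = ρ E a (λ tE → ρ² d b (f tE))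

    J : Fin k → Fin k → Fin k → ℤ
    J a d b = ρ³ a d b (λ tE tA tH → δ a ⊞ δ d ⊞ δ b ⊞ tE ⊞ tA ⊞ tH)

    Σ³ : (Fin k → Fin k → Fin k → ℤ) → ℤ
    Σ³ Q = ∑[ a < k ] ∑[ d < k ] ∑[ b < k ] (Q a d b * J a d b)

    J-cong : ∀ a d b {f : Vec ℕ k → Vec ℕ k → Vec ℕ k → Vec ℕ k} →
      (∀ tE tA tH → f tE tA tH ≡ δ a ⊞ δ d ⊞ δ b ⊞ tE ⊞ tA ⊞ tH) → ρ³ a d b f ≡ J a d b
    J-cong a d b f≡ = rootedColourings-cong E a λ tE → rootedColourings-cong A d λ tA →
      rootedColourings-cong H b λ tH → cong 𝟙α (f≡ tE tA tH)

    *-sum-* : ∀ s (t x : Fin k → ℤ) → s * ∑[ d < k ] (t d * x d) ≡ ∑[ d < k ] (s * t d * x d)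
    *-sum-* s t x = trans (*-distribˡ-sum s (λ d → t d * x d)) (sum-cong-≗ λ d → sym (*-assoc s (t d) (x d)))

    W₂ : Rooted
    W₂ = wedge (extend A) H

    X-centreH : X (underlying (wedge (extend E) W₂)) α ≡ Σ³ (λ a d b → apart b a * apart b d)
    X-centreH = begin
      X (underlying (wedge (extend E) W₂)) α
        ≡⟨ X-colourings (underlying (wedge (extend E) W₂)) α ⟩
      colourings (underlying (wedge (extend E) W₂)) 𝟙α
        ≡⟨ colourings-underlying (wedge (extend E) W₂) 𝟙α ⟩
      ∑[ b < k ] ρ (wedge (extend E) W₂) b (λ t → 𝟙α (δ b ⊞ t))
        ≡⟨ sum-cong-≗ (λ b → rootedColourings-wedge-extend E W₂ b (λ t → 𝟙α (δ b ⊞ t))) ⟩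
      ∑[ b < k ] ∑[ a < k ] (apart b a * ρ E a (λ tE → ρ W₂ b (λ t → 𝟙α (δ b ⊞ (δ a ⊞ tE) ⊞ t))))
        ≡⟨ sum-cong-≗ (λ b → sum-cong-≗ λ a → cong (apart b a *_) (expand a b)) ⟩
      ∑[ b < k ] ∑[ a < k ] (apart b a * ∑[ d < k ] (apart b d * J a d b))
        ≡⟨ sum-cong-≗ (λ b → sum-cong-≗ λ a → *-sum-* (apart b a) (apart b) (λ d → J a d b)) ⟩
      ∑[ b < k ] ∑[ a < k ] ∑[ d < k ] (apart b a * apart b d * J a d b)
        ≡⟨ sum-comm (λ b a → ∑[ d < k ] (apart b a * apart b d * J a d b)) ⟩
      ∑[ a < k ] ∑[ b < k ] ∑[ d < k ] (apart b a * apart b d * J a d b)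
        ≡⟨ sum-cong-≗ (λ a → sum-comm (λ b d → apart b a * apart b d * J a d b)) ⟩
      Σ³ (λ a d b → apart b a * apart b d) ∎
      where
      open ≡-Reasoning
      V : Fin k → Fin k → Fin k → Vec ℕ k → Vec ℕ k → Vec ℕ k → Vec ℕ k
      V a d b tE tA tH = δ b ⊞ (δ a ⊞ tE) ⊞ (δ d ⊞ tA) ⊞ tH
      expand : ∀ a b →
        ρ E a (λ tE → ρ W₂ b (λ t → 𝟙α (δ b ⊞ (δ a ⊞ tE) ⊞ t))) ≡ ∑[ d < k ] (apart b d * J a d b)
      expand a b = begin
        ρ E a (λ tE → ρ W₂ b (λ t → 𝟙α (δ b ⊞ (δ a ⊞ tE) ⊞ t)))
          ≡⟨ rootedColourings-cong E a (λ tE →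
               rootedColourings-wedge-extend A H b (λ t → 𝟙α (δ b ⊞ (δ a ⊞ tE) ⊞ t))) ⟩
        ρ E a (λ tE → ∑[ d < k ] (apart b d * ρ² d b (V a d b tE)))
          ≡⟨ rootedColourings-linear E a (apart b) (λ d tE → ρ² d b (V a d b tE)) ⟩
        ∑[ d < k ] (apart b d * ρ³ a d b (V a d b))
          ≡⟨ sum-cong-≗ (λ d → cong (apart b d *_) (J-cong a d b λ tE tA tH →
               solve 6 (λ a d b tE tA tH → b ⊕ (a ⊕ tE) ⊕ (d ⊕ tA) ⊕ tH ⊜ a ⊕ d ⊕ b ⊕ tE ⊕ tA ⊕ tH)
                 refl (δ a) (δ d) (δ b) tE tA tH)) ⟩
        ∑[ d < k ] (apart b d * J a d b) ∎

    W₃ : Rooted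
    W₃ = wedge (extend A) (wedge (extend H) K1)

    X-centreE : X (underlying (wedge E W₃)) α ≡ Σ³ (λ a d b → apart a d * apart a b)
    X-centreE = begin
      X (underlying (wedge E W₃)) α
        ≡⟨ X-colourings (underlying (wedge E W₃)) α ⟩
      colourings (underlying (wedge E W₃)) 𝟙α
        ≡⟨ colourings-underlying (wedge E W₃) 𝟙α ⟩
      ∑[ a < k ] ρ (wedge E W₃) a (λ t → 𝟙α (δ a ⊞ t))
        ≡⟨ sum-cong-≗ (λ a → rootedColourings-wedge E W₃ a (λ t → 𝟙α (δ a ⊞ t))) ⟩
      ∑[ a < k ] ρ E a (λ tE → ρ W₃ a (λ t → 𝟙α (δ a ⊞ tE ⊞ t)))
        ≡⟨ sum-cong-≗ (λ a → trans (rootedColourings-cong E a λ tE → expand a tE)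
             (rootedColourings-linear E a (apart a) (λ d tE → ∑[ b < k ] (apart a b * ρ² d b (V a d b tE))))) ⟩
      ∑[ a < k ] ∑[ d < k ] (apart a d * ρ E a (λ tE → ∑[ b < k ] (apart a b * ρ² d b (V a d b tE))))
        ≡⟨ sum-cong-≗ (λ a → sum-cong-≗ λ d → cong (apart a d *_)
             (trans (rootedColourings-linear E a (apart a) (λ b tE → ρ² d b (V a d b tE)))
               (sum-cong-≗ λ b → cong (apart a b *_) (J-cong a d b λ tE tA tH →
                 solve 6 (λ a d b tE tA tH → a ⊕ tE ⊕ (d ⊕ tA) ⊕ (b ⊕ tH) ⊕ id ⊜ a ⊕ d ⊕ b ⊕ tE ⊕ tA ⊕ tH)
                   refl (δ a) (δ d) (δ b) tE tA tH)))) ⟩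
      ∑[ a < k ] ∑[ d < k ] (apart a d * ∑[ b < k ] (apart a b * J a d b))
        ≡⟨ sum-cong-≗ (λ a → sum-cong-≗ λ d → *-sum-* (apart a d) (apart a) (J a d)) ⟩
      Σ³ (λ a d b → apart a d * apart a b) ∎
      where
      open ≡-Reasoning
      V : Fin k → Fin k → Fin k → Vec ℕ k → Vec ℕ k → Vec ℕ k → Vec ℕ k
      V a d b tE tA tH = δ a ⊞ tE ⊞ (δ d ⊞ tA) ⊞ (δ b ⊞ tH) ⊞ 0̄
      expand : ∀ a tE →
        ρ W₃ a (λ t → 𝟙α (δ a ⊞ tE ⊞ t)) ≡ ∑[ d < k ] (apart a d * ∑[ b < k ] (apart a b * ρ² d b (V a d b tE)))
      expand a tE = begin
        ρ W₃ a (λ t → 𝟙α (δ a ⊞ tE ⊞ t))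
          ≡⟨ rootedColourings-wedge-extend A (wedge (extend H) K1) a (λ t → 𝟙α (δ a ⊞ tE ⊞ t)) ⟩
        ∑[ d < k ] (apart a d * ρ A d (λ tA → ρ (wedge (extend H) K1) a (λ t → 𝟙α (δ a ⊞ tE ⊞ (δ d ⊞ tA) ⊞ t))))
          ≡⟨ sum-cong-≗ (λ d → cong (apart a d *_) (rootedColourings-cong A d λ tA →
               trans (rootedColourings-wedge-extend H K1 a (λ t → 𝟙α (δ a ⊞ tE ⊞ (δ d ⊞ tA) ⊞ t)))
                 (sum-cong-≗ λ b → cong (apart a b *_) (rootedColourings-cong H b λ tH →
                   rootedColourings-K1 a (λ t → 𝟙α (δ a ⊞ tE ⊞ (δ d ⊞ tA) ⊞ (δ b ⊞ tH) ⊞ t)))))) ⟩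
        ∑[ d < k ] (apart a d * ρ A d (λ tA → ∑[ b < k ] (apart a b * ρ H b (λ tH → 𝟙α (V a d b tE tA tH)))))
          ≡⟨ sum-cong-≗ (λ d → cong (apart a d *_)
               (rootedColourings-linear A d (apart a) (λ b tA → ρ H b (λ tH → 𝟙α (V a d b tE tA tH))))) ⟩
        ∑[ d < k ] (apart a d * ∑[ b < k ] (apart a b * ρ² d b (V a d b tE))) ∎

    X-tail⊗ : (X (underlying (wedge E K1)) ⊗ X (underlying W₂)) α ≡ Σ³ (λ a d b → apart b d)
    X-tail⊗ = begin
      (X (underlying (wedge E K1)) ⊗ X (underlying W₂)) α
        ≡⟨ X-⊗ (underlying (wedge E K1)) (underlying W₂) α ⟩
      colourings (underlying (wedge E K1)) (λ t → C₂ (t ⊞_))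
        ≡⟨ colourings-underlying (wedge E K1) (λ t → C₂ (t ⊞_)) ⟩
      ∑[ a < k ] ρ (wedge E K1) a (λ t → C₂ ((δ a ⊞ t) ⊞_))
        ≡⟨ sum-cong-≗ (λ a → trans (rootedColourings-wedge E K1 a (λ t → C₂ ((δ a ⊞ t) ⊞_)))
             (rootedColourings-cong E a λ tE → trans (rootedColourings-K1 a (λ t → C₂ ((δ a ⊞ tE ⊞ t) ⊞_)))
               (expand a tE))) ⟩
      ∑[ a < k ] ρ E a (λ tE → ∑[ b < k ] ∑[ d < k ] (apart b d * ρ² d b (V a d b tE)))
        ≡⟨ sum-cong-≗ (λ a → trans (rootedColourings-sum E a (λ b tE → ∑[ d < k ] (apart b d * ρ² d b (V a d b tE))))
             (sum-cong-≗ λ b → rootedColourings-linear E a (apart b) (λ d tE → ρ² d b (V a d b tE)))) ⟩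
      ∑[ a < k ] ∑[ b < k ] ∑[ d < k ] (apart b d * ρ³ a d b (V a d b))
        ≡⟨ sum-cong-≗ (λ a → sum-cong-≗ λ b → sum-cong-≗ λ d → cong (apart b d *_) (J-cong a d b λ tE tA tH →
             solve 6 (λ a d b tE tA tH → (a ⊕ tE ⊕ id) ⊕ (b ⊕ (d ⊕ tA) ⊕ tH) ⊜ a ⊕ d ⊕ b ⊕ tE ⊕ tA ⊕ tH)
               refl (δ a) (δ d) (δ b) tE tA tH)) ⟩
      ∑[ a < k ] ∑[ b < k ] ∑[ d < k ] (apart b d * J a d b)
        ≡⟨ sum-cong-≗ (λ a → sum-comm (λ b d → apart b d * J a d b)) ⟩
      Σ³ (λ a d b → apart b d) ∎
      where
      open ≡-Reasoning
      C₂ : (Vec ℕ k → Vec ℕ k) → ℤ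
      C₂ g = colourings (underlying W₂) (λ t' → 𝟙α (g t'))
      V : Fin k → Fin k → Fin k → Vec ℕ k → Vec ℕ k → Vec ℕ k → Vec ℕ k
      V a d b tE tA tH = (δ a ⊞ tE ⊞ 0̄) ⊞ (δ b ⊞ (δ d ⊞ tA) ⊞ tH)
      expand : ∀ a tE → C₂ ((δ a ⊞ tE ⊞ 0̄) ⊞_) ≡ ∑[ b < k ] ∑[ d < k ] (apart b d * ρ² d b (V a d b tE))
      expand a tE = trans (colourings-underlying W₂ (λ t' → 𝟙α ((δ a ⊞ tE ⊞ 0̄) ⊞ t')))
        (sum-cong-≗ λ b → rootedColourings-wedge-extend A H b (λ t → 𝟙α ((δ a ⊞ tE ⊞ 0̄) ⊞ (δ b ⊞ t))))

    X-path⊗ : (X (underlying (wedge E (extend A))) ⊗ X (underlying H)) α ≡ Σ³ (λ a d b → apart a d)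
    X-path⊗ = begin
      (X (underlying (wedge E (extend A))) ⊗ X (underlying H)) α
        ≡⟨ X-⊗ (underlying (wedge E (extend A))) (underlying H) α ⟩
      colourings (underlying (wedge E (extend A))) (λ t → C₁ (t ⊞_))
        ≡⟨ colourings-underlying (wedge E (extend A)) (λ t → C₁ (t ⊞_)) ⟩
      ∑[ a < k ] ρ (wedge E (extend A)) a (λ t → C₁ ((δ a ⊞ t) ⊞_))
        ≡⟨ sum-cong-≗ (λ a → trans (rootedColourings-wedge E (extend A) a (λ t → C₁ ((δ a ⊞ t) ⊞_)))
             (rootedColourings-cong E a λ tE → expand a tE)) ⟩
      ∑[ a < k ] ρ E a (λ tE → ∑[ d < k ] (apart a d * ∑[ b < k ] ρ² d b (V a d b tE)))
        ≡⟨ sum-cong-≗ (λ a → trans (rootedColourings-linear E a (apart a) (λ d tE → ∑[ b < k ] ρ² d b (V a d b tE)))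
             (sum-cong-≗ λ d → cong (apart a d *_) (rootedColourings-sum E a (λ b tE → ρ² d b (V a d b tE))))) ⟩
      ∑[ a < k ] ∑[ d < k ] (apart a d * ∑[ b < k ] ρ³ a d b (V a d b))
        ≡⟨ sum-cong-≗ (λ a → sum-cong-≗ λ d → trans (*-distribˡ-sum (apart a d) (λ b → ρ³ a d b (V a d b)))
             (sum-cong-≗ λ b → cong (apart a d *_) (J-cong a d b λ tE tA tH →
               solve 6 (λ a d b tE tA tH → (a ⊕ tE ⊕ d ⊕ tA) ⊕ (b ⊕ tH) ⊜ a ⊕ d ⊕ b ⊕ tE ⊕ tA ⊕ tH)
                 refl (δ a) (δ d) (δ b) tE tA tH))) ⟩
      Σ³ (λ a d b → apart a d) ∎
      where
      open ≡-Reasoning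
      C₁ : (Vec ℕ k → Vec ℕ k) → ℤ
      C₁ g = colourings (underlying H) (λ t' → 𝟙α (g t'))
      V : Fin k → Fin k → Fin k → Vec ℕ k → Vec ℕ k → Vec ℕ k → Vec ℕ k
      V a d b tE tA tH = (δ a ⊞ tE ⊞ δ d ⊞ tA) ⊞ (δ b ⊞ tH)
      expand : ∀ a tE →
        ρ (extend A) a (λ t → C₁ ((δ a ⊞ tE ⊞ t) ⊞_)) ≡ ∑[ d < k ] (apart a d * ∑[ b < k ] ρ² d b (V a d b tE))
      expand a tE = trans (rootedColourings-extend A a (λ t → C₁ ((δ a ⊞ tE ⊞ t) ⊞_)))
        (sum-cong-≗ λ d → cong (apart a d *_)
          (trans (rootedColourings-cong A d λ tA → colourings-underlying H (λ t' → 𝟙α ((δ a ⊞ tE ⊞ δ d ⊞ tA) ⊞ t')))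
            (rootedColourings-sum A d (λ b tA → ρ H b (λ tH → 𝟙α (V a d b tE tA tH))))))

    Σ³-+ : ∀ Q Q' → Σ³ (λ a d b → Q a d b + Q' a d b) ≡ Σ³ Q + Σ³ Q'
    Σ³-+ Q Q' = trans (sum-cong-≗ λ a → trans (sum-cong-≗ λ d → trans
        (sum-cong-≗ λ b → *-distribʳ-+ (J a d b) (Q a d b) (Q' a d b))
        (sum-+ (λ b → Q a d b * J a d b) (λ b → Q' a d b * J a d b)))
        (sum-+ (λ d → ∑[ b < k ] (Q a d b * J a d b)) (λ d → ∑[ b < k ] (Q' a d b * J a d b))))
      (sum-+ (λ a → ∑[ d < k ] ∑[ b < k ] (Q a d b * J a d b)) (λ a → ∑[ d < k ] ∑[ b < k ] (Q' a d b * J a d b)))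

    Σ³-cong : ∀ {Q Q'} → (∀ a d b → Q a d b ≡ Q' a d b) → Σ³ Q ≡ Σ³ Q'
    Σ³-cong Q≗Q' = sum-cong-≗ λ a → sum-cong-≗ λ d → sum-cong-≗ λ b → cong (_* J a d b) (Q≗Q' a d b)

    X-spider-identity : X (underlying (wedge (extend E) W₂)) α
      ≡ X (underlying (wedge E W₃)) α + (X (underlying (wedge E K1)) ⊗ X (underlying W₂)) α
        - (X (underlying (wedge E (extend A))) ⊗ X (underlying H)) α
    X-spider-identity = begin
      X (underlying (wedge (extend E) W₂)) α
        ≡⟨ X-centreH ⟩
      Σ³ (λ a d b → apart b a * apart b d)
        ≡⟨ x+w≡y+z⇒x≡y+z-w {y = Σ³ (λ a d b → apart a d * apart a b)} {z = Σ³ (λ a d b → apart b d)} weights ⟩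
      Σ³ (λ a d b → apart a d * apart a b) + Σ³ (λ a d b → apart b d) - Σ³ (λ a d b → apart a d)
        ≡⟨ cong₂ _-_ (cong₂ _+_ X-centreE X-tail⊗) X-path⊗ ⟨
      X (underlying (wedge E W₃)) α + (X (underlying (wedge E K1)) ⊗ X (underlying W₂)) α
        - (X (underlying (wedge E (extend A))) ⊗ X (underlying H)) α ∎
      where
      open ≡-Reasoning
      weights : Σ³ (λ a d b → apart b a * apart b d) + Σ³ (λ a d b → apart a d)
        ≡ Σ³ (λ a d b → apart a d * apart a b) + Σ³ (λ a d b → apart b d)
      weights = begin
        Σ³ (λ a d b → apart b a * apart b d) + Σ³ (λ a d b → apart a d)
          ≡⟨ Σ³-+ (λ a d b → apart b a * apart b d) (λ a d b → apart a d) ⟨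
        Σ³ (λ a d b → apart b a * apart b d + apart a d)
          ≡⟨ Σ³-cong apart-triangle ⟩
        Σ³ (λ a d b → apart a d * apart a b + apart b d)
          ≡⟨ Σ³-+ (λ a d b → apart a d * apart a b) (λ a d b → apart b d) ⟩
        Σ³ (λ a d b → apart a d * apart a b) + Σ³ (λ a d b → apart b d) ∎

open import Defs
open import Data.Nat using (ℕ; _≤_; _+_; _∸_)
open import Data.List using (List; []; _∷_; length)
open import Data.Product using (_×_; _,_)
open import Data.Nat using (suc)
open import Data.Nat.Properties using (+-comm)
open import Relation.Binary.PropositionalEquality using (cong; trans; sym)
open import Data.Integer using () renaming (_+_ to _+ℤ_; _-_ to _-ℤ_)

proposition4p1 : (τ₁ τ₂ : ℕ) (G₁ G₂ : Rooted) (rest : List (ℕ × Rooted))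
    → 1 ≤ τ₁ → 1 ≤ τ₂ → 1 ≤ length rest
    → X (underlying (spider ((τ₁ , G₁) ∷ (τ₂ , G₂) ∷ rest)))
      ≈ X (underlying (spider ((τ₁ ∸ 1 , G₁) ∷ (τ₂ , G₂) ∷ (1 , spider rest) ∷ [])))
        ⊕ X (tailed (τ₁ ∸ 1) G₁) ⊗ X (underlying (spider ((τ₂ , G₂) ∷ rest)))
        ⊖ X (P (τ₁ + τ₂ ∸ 1) G₁ G₂) ⊗ X (underlying (spider rest))
-- The identity also holds when rest is empty (H = K₁).
proposition4p1 (suc t₁) (suc t₂) G₁ G₂ rest _ _ _ α =
  trans (SpiderIdentity.X-spider-identity α (extendN t₁ G₁) (extendN t₂ G₂) (spider rest))
    (cong (λ z → X (underlying (spider ((t₁ , G₁) ∷ (suc t₂ , G₂) ∷ (1 , spider rest) ∷ []))) α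
                   +ℤ (X (tailed t₁ G₁) ⊗ X (underlying (spider ((suc t₂ , G₂) ∷ rest)))) α -ℤ z)
      (SeriesProduct.⊗-congʳ (X (underlying (spider rest))) path-slide α))
  where
  path-slide : X (underlying (wedge (extendN t₁ G₁) (extendN (suc t₂) G₂))) ≈ X (P (t₁ + suc t₂) G₁ G₂)
  path-slide β = sym (trans (cong (λ n → X (underlying (wedge (extendN n G₁) G₂)) β) (+-comm t₁ (suc t₂)))
    (Sliding.X-slide (suc t₂) t₁ G₁ G₂ β))
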